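{- Let $\kappa>\frac76$ be a constant and $\varrho\ge\kappa\ln n$. Then for any integers $d_1,d_2\ge1$, for $\varphi$ drawn from $\Phi^{\sf plant}(n,\varrho n)$ with the all-ones planted assignment, whp there are no two distinct $d_1$-isolated variables at distance at most $d_2$ from each other.
   Context: $\Phi^{\sf plant}(n,\varrho n)$ with the all-ones planted assignment: $\varrho n$ clauses (3 literals on 3 distinct variables among $x_1,\dots,x_n$) chosen independently and uniformly from the $7\binom n3$ clauses containing at least one positive literal. A clause has type $(+,-,-)$ if it has exactly one positive literal. A variable is $k$-isolated if it appears positively in at most $k$ clauses of type $(+,-,-)$. The primal graph $G(\varphi)$ has vertices $x_1,\dots,x_n$ and an edge between two variables occurring in a common clause; the distance between variables is the length of a shortest path in $G(\varphi)$. Whp means with probability tending to 1 as $n\to\infty$.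
   Formalization: The constant κ ranges only over the rationals greater than 7/6. -}

module Defs where

open import Data.Nat using (ℕ; zero; suc; _+_; _*_; _^_; _≤_; _<_; _<ᵇ_)
open import Data.Nat using (_!)
open import Data.Nat.ListAction using (sum)
open import Data.Bool.ListAction using (any)
open import Data.Bool using (Bool; true; false; _∧_; _∨_; not; if_then_else_)
open import Data.Fin using (Fin; toℕ)
open import Data.Fin.Properties using () renaming (_≟_ to _≟ᶠ_)
open import Data.List using (List; []; _∷_; concatMap; map; length; filterᵇ)
open import Data.List using () renaming (allFin to allFinL)
open import Data.Vec using (Vec; []; _∷_; toList)
open import Data.Product using (_×_; _,_; proj₁; proj₂)
open import Relation.Nullary.Decidable using (⌊_⌋)

-- Literals and clauses over variables x_1..x_n (encoded as Fin n).
-- A literal is a variable together with its sign (true = positive).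

Lit : ℕ → Set
Lit n = Fin n × Bool

-- The enumeration below only produces clauses
-- on three distinct variables (in increasing order) with at least one
-- positive literal, i.e. exactly the 7·C(n,3) admissible clauses.
Clause : ℕ → Set
Clause n = Lit n × Lit n × Lit n

lits : ∀ {n} → Clause n → List (Lit n)
lits (a , b , c) = a ∷ b ∷ c ∷ []

signPatterns : List (Bool × Bool × Bool)
signPatterns =
  (true , true , true) ∷ (true , true , false) ∷ (true , false , true) ∷
  (true , false , false) ∷ (false , true , true) ∷ (false , true , false) ∷
  (false , false , true) ∷ []

allClauses : ∀ n → List (Clause n)
allClauses n =
  concatMap (λ i → concatMap (λ j → concatMap (λ k →
    if (toℕ i <ᵇ toℕ j) ∧ (toℕ j <ᵇ toℕ k)
      then map (λ { (s , t , u) → ((i , s) , (j , t) , (k , u)) }) signPatterns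
      else []) (allFinL n)) (allFinL n)) (allFinL n)

-- A formula with m clauses = a sequence of m clauses (drawn independently).
Formula : ℕ → ℕ → Set
Formula n m = Vec (Clause n) m

-- Uniform probability space: counting formulas satisfying a predicate.

countF : ∀ n m → (Formula n m → Bool) → ℕ
countF n zero P = if P [] then 1 else 0
countF n (suc m) P = sum (map (λ c → countF n m (λ v → P (c ∷ v))) (allClauses n))

_==_ : ∀ {n} → Fin n → Fin n → Bool
x == y = ⌊ x ≟ᶠ y ⌋

numPos : ∀ {n} → Clause n → ℕ
numPos c = length (filterᵇ proj₂ (lits c))

isPMM : ∀ {n} → Clause n → Bool
isPMM c = numPos c Data.Nat.≡ᵇ 1

posIn : ∀ {n} → Fin n → Clause n → Bool
posIn x c = any (λ l → (proj₁ l == x) ∧ proj₂ l) (lits c)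

occIn : ∀ {n} → Fin n → Clause n → Bool
occIn x c = any (λ l → proj₁ l == x) (lits c)

-- number of clauses of type (+,-,-) of φ (counted as they appear in the
-- sequence φ) in which x appears positively
posPMMCount : ∀ {n m} → Formula n m → Fin n → ℕ
posPMMCount φ x = length (filterᵇ (λ c → isPMM c ∧ posIn x c) (toList φ))

isolated : ∀ {n m} → ℕ → Formula n m → Fin n → Bool
isolated k φ x = posPMMCount φ x Data.Nat.≤ᵇ k

adj : ∀ {n m} → Formula n m → Fin n → Fin n → Bool
adj φ x y = not (x == y) ∧ any (λ c → occIn x c ∧ occIn y c) (toList φ)

withinDist : ∀ {n m} → Formula n m → ℕ → Fin n → Fin n → Bool
withinDist φ zero x y = x == y
withinDist {n} φ (suc d) x y =
  withinDist φ d x y ∨ any (λ z → withinDist φ d x z ∧ adj φ z y) (allFinL n)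

badEvent : ∀ {n m} → ℕ → ℕ → Formula n m → Bool
badEvent {n} d₁ d₂ φ =
  any (λ x → any (λ y →
    not (x == y) ∧ isolated d₁ φ x ∧ isolated d₁ φ y ∧ withinDist φ d₂ x y)
    (allFinL n)) (allFinL n)

-- The density condition ρ ≥ κ ln n, with m = ρ n clauses and κ = p / q.
--
-- m/n ≥ (p/q) ln n  ⇔  e^{q m} ≥ n^{p n}.
-- expScaled x J = J! · Σ_{j ≤ J} x^j / j!  (a natural number).
-- Since e^x (x ∈ ℕ, x ≥ 1) is irrational, e^x ≥ N ⇔ some partial sum of
-- the exponential series is ≥ N; for x = 0 this also holds.
expScaled : ℕ → ℕ → ℕ
expScaled x zero = 1
expScaled x (suc J) = suc J * expScaled x J + x ^ suc J

-- e^x ≥ N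
ExpAtLeast : ℕ → ℕ → Set
ExpAtLeast x N = Data.Product.∃ λ J → N * (J !) ≤ expScaled x J

DensityAtLeast : (p q n m : ℕ) → Set
DensityAtLeast p q n m = ExpAtLeast (q * m) (n ^ (p * n))

-- Fix distinct variables x and y.  If both are d₁-isolated and at distance k ≤ d₂, a shortest path
-- from x to y in G(φ) has each of its k edges covered by a clause of φ, and no clause covers two
-- of them (that would give a shortcut).  Reading the clauses of φ one at a time, each either covers
-- a path edge (O(n) clauses per edge), or is one of the at most 2d₁ permitted (+,-,-) clauses with
-- x or y positive, or avoids all 2·C(n-1,2) such clauses, a fraction (7n-6)/(7n) of all clauses.
-- Summing over pairs and paths, the fraction of bad formulas is at most C · n · ((n+m)/n)^D ·
-- ((7n-6)/(7n))^m with D = 2d₁ + d₂.  Finally ((7n-6)/(7n))^m decays geometrically in m/n, and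
-- m ≥ κ n ln n with κ > 7/6 makes it at most n^(-6κ/7) where 6κ/7 > 1, so the bound tends to 0.

module Submission where

open import Defs
open import Data.Nat
open import Data.Nat.Properties
open import Data.Nat.DivMod
open import Data.Nat.ListAction using (sum)
open import Data.Nat.Tactic.RingSolver
open import Data.Bool using (Bool; true; false; _∧_; _∨_; not; if_then_else_)
open import Data.Bool.Properties using (∧-identityʳ; ∧-zeroʳ; ∨-identityʳ; T-≡; ¬-not; not-involutive)
open import Data.Bool.ListAction using (any)
open import Data.Fin using (Fin; zero; suc; toℕ)
open import Data.Fin.Properties using () renaming (_≟_ to _≟F_)
open import Data.List using (List; []; _∷_; map; filterᵇ; length; concatMap; concat; _++_; tabulate)
open import Data.List using () renaming (allFin to allFinL)
open import Data.List.Membership.Propositional using (_∈_)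
open import Data.List.Relation.Unary.Any as Any using (here; there)
open import Data.List.Properties using (length-++; length-map; map-cong)
open import Data.List.Membership.Propositional.Properties using (∈-map⁺; ∈-map⁻; ∈-++⁻; ∈-concatMap⁺; ∈-allFin)
open import Function.Bundles using (Equivalence)
open import Data.Vec using ([]; _∷_; toList)
open import Data.Product using (_×_; _,_; proj₁; proj₂; ∃)
open import Data.Sum using (inj₁; inj₂)
open import Data.Empty using (⊥; ⊥-elim)
open import Relation.Nullary using (yes; no; ¬_; contradiction)
open import Relation.Binary.PropositionalEquality
open import Algebra.Properties.CommutativeSemigroup +-commutativeSemigroup using (interchange)
open import Algebra.Properties.CommutativeSemigroup *-commutativeSemigroup using (x∙yz≈y∙xz)


-- Booleans, counts and finite sums

false≢true : false ≢ true
false≢true ()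

∧-elimˡ : ∀ {a b} → a ∧ b ≡ true → a ≡ true
∧-elimˡ {true} h = refl
∧-elimʳ : ∀ {a b} → a ∧ b ≡ true → b ≡ true
∧-elimʳ {true} h = h
∧-intro : ∀ {a b} → a ≡ true → b ≡ true → a ∧ b ≡ true
∧-intro refl refl = refl

∨-introˡ : ∀ {a} b → a ≡ true → a ∨ b ≡ true
∨-introˡ b refl = refl
∨-introʳ : ∀ a {b} → b ≡ true → a ∨ b ≡ true
∨-introʳ true h = refl
∨-introʳ false h = h

≤ᵇ≡true⇒≤ : ∀ {m n} → (m ≤ᵇ n) ≡ true → m ≤ n
≤ᵇ≡true⇒≤ {m} {n} h = ≤ᵇ⇒≤ m n (Equivalence.from T-≡ h)

≤⇒≤ᵇ≡true : ∀ {m n} → m ≤ n → (m ≤ᵇ n) ≡ true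
≤⇒≤ᵇ≡true h = Equivalence.to T-≡ (≤⇒≤ᵇ h)

==⇒≡ : ∀ {n} {a b : Fin n} → (a == b) ≡ true → a ≡ b
==⇒≡ {a = a} {b} h with a ≟F b
... | yes p = p
==⇒≡ {a = a} {b} () | no p

==-refl : ∀ {n} (a : Fin n) → (a == a) ≡ true
==-refl a with a ≟F a
... | yes p = refl
... | no p = ⊥-elim (p refl)

==-sym : ∀ {n} (a b : Fin n) → (a == b) ≡ true → (b == a) ≡ true
==-sym a b h rewrite ==⇒≡ h = ==-refl b

suc==suc : ∀ {n} (i x : Fin n) → (suc i == suc x) ≡ (i == x)
suc==suc i x with i ≟F x
... | yes p = refl
... | no p = refl

==-trans₂ : ∀ {n} (p u w : Fin n) → (p == u) ≡ true → (p == w) ≡ true → (u == w) ≡ true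
==-trans₂ p u w h1 h2 rewrite sym (==⇒≡ h1) | sym (==⇒≡ h2) = ==-refl p

==-both-false : ∀ {n} (x y v : Fin n) → (x == y) ≡ false → (v == x) ∧ (v == y) ≡ false
==-both-false x y v h with v == x in e1 | v == y in e2
... | true | true rewrite ==⇒≡ e1 | ==⇒≡ e2 | ==-refl y = ⊥-elim (false≢true (sym h))
... | true | false = refl
... | false | _ = refl


𝟙 : Bool → ℕ
𝟙 true = 1
𝟙 false = 0

𝟙-≤ : ∀ k → 𝟙 (1 ≤ᵇ k) ≤ k
𝟙-≤ zero = z≤n
𝟙-≤ (suc k) = s≤s z≤n

𝟙-∧false-* : ∀ b x → 𝟙 (b ∧ false) * x ≡ 0
𝟙-∧false-* true x = refl
𝟙-∧false-* false x = refl

countᵇ : ∀ {A : Set} → (A → Bool) → List A → ℕ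
countᵇ p xs = sum (map (λ x → 𝟙 (p x)) xs)

countᵇ-true : ∀ {A : Set} (xs : List A) → countᵇ (λ _ → true) xs ≡ length xs
countᵇ-true [] = refl
countᵇ-true (x ∷ xs) = cong suc (countᵇ-true xs)

countᵇ-++ : ∀ {A : Set} (p : A → Bool) xs ys → countᵇ p (xs ++ ys) ≡ countᵇ p xs + countᵇ p ys
countᵇ-++ p [] ys = refl
countᵇ-++ p (x ∷ xs) ys = trans (cong (𝟙 (p x) +_) (countᵇ-++ p xs ys)) (sym (+-assoc (𝟙 (p x)) _ _))

countᵇ-concatMap : ∀ {A B : Set} (p : B → Bool) (f : A → List B) xs → countᵇ p (concatMap f xs) ≡ sum (map (λ a → countᵇ p (f a)) xs)
countᵇ-concatMap p f [] = refl
countᵇ-concatMap p f (x ∷ xs) = trans (countᵇ-++ p (f x) (concat (map f xs))) (cong (countᵇ p (f x) +_) (countᵇ-concatMap p f xs))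

countᵇ-if : ∀ {A : Set} (p : A → Bool) b (xs : List A) → countᵇ p (if b then xs else []) ≡ 𝟙 b * countᵇ p xs
countᵇ-if p true xs = sym (+-identityʳ _)
countᵇ-if p false xs = refl

countᵇ-filterᵇ-≤ : ∀ {A : Set} (p q : A → Bool) xs → countᵇ p (filterᵇ q xs) ≤ countᵇ p xs
countᵇ-filterᵇ-≤ p q [] = z≤n
countᵇ-filterᵇ-≤ p q (x ∷ xs) with q x
... | true = +-monoʳ-≤ (𝟙 (p x)) (countᵇ-filterᵇ-≤ p q xs)
... | false = ≤-trans (countᵇ-filterᵇ-≤ p q xs) (m≤n+m _ (𝟙 (p x)))


any-∈ : ∀ {A : Set} (p : A → Bool) {xs} {a} → a ∈ xs → p a ≡ true → any p xs ≡ true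
any-∈ p {x ∷ xs} (here refl) h = ∨-introˡ (any p xs) h
any-∈ p {x ∷ xs} (there m) h = ∨-introʳ (p x) (any-∈ p m h)

any-witness : ∀ {A : Set} (p : A → Bool) xs → any p xs ≡ true → ∃ λ a → a ∈ xs × p a ≡ true
any-witness p (x ∷ xs) h = go (p x) refl
  where
  go : ∀ b → p x ≡ b → ∃ λ a → a ∈ (x ∷ xs) × p a ≡ true
  go true e = x , here refl , e
  go false e with any-witness p xs (subst (λ z → z ∨ any p xs ≡ true) e h)
  ... | a , m , pa = a , there m , pa

any-mono : ∀ {A : Set} (p q : A → Bool) xs → (∀ a → p a ≡ true → q a ≡ true) → any p xs ≡ true → any q xs ≡ true
any-mono p q xs h h2 with any-witness p xs h2
... | a , m , pa = any-∈ q m (h a pa)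

any-map⁺ : ∀ {A B : Set} (p : A → Bool) (q : B → Bool) (f : A → B) xs → (∀ a → p a ≡ true → q (f a) ≡ true) →
  any p xs ≡ true → any q (map f xs) ≡ true
any-map⁺ p q f xs h h2 with any-witness p xs h2
... | a , a∈xs , pa = any-∈ q (∈-map⁺ f a∈xs) (h a pa)

any-concatMap⁺ : ∀ {A B : Set} (p : B → Bool) (f : A → List B) xs a → a ∈ xs → any p (f a) ≡ true → any p (concatMap f xs) ≡ true
any-concatMap⁺ p f xs a a∈xs h with any-witness p (f a) h
... | b , b∈fa , pb = any-∈ p (∈-concatMap⁺ f (Any.map (λ { refl → b∈fa }) a∈xs)) pb

sum-map-mono : ∀ {A : Set} (f g : A → ℕ) xs → (∀ a → f a ≤ g a) → sum (map f xs) ≤ sum (map g xs)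
sum-map-mono f g [] h = z≤n
sum-map-mono f g (x ∷ xs) h = +-mono-≤ (h x) (sum-map-mono f g xs h)

sum-map-mono-∈ : ∀ {A : Set} (f g : A → ℕ) xs → (∀ a → a ∈ xs → f a ≤ g a) → sum (map f xs) ≤ sum (map g xs)
sum-map-mono-∈ f g [] h = z≤n
sum-map-mono-∈ f g (x ∷ xs) h = +-mono-≤ (h x (here refl)) (sum-map-mono-∈ f g xs (λ a m → h a (there m)))

sum-map-+ : ∀ {A : Set} (f g : A → ℕ) xs → sum (map (λ a → f a + g a) xs) ≡ sum (map f xs) + sum (map g xs)
sum-map-+ f g [] = refl
sum-map-+ f g (x ∷ xs) rewrite sum-map-+ f g xs = interchange (f x) (g x) (sum (map f xs)) (sum (map g xs))

sum-map-const : ∀ {A : Set} (k : ℕ) (xs : List A) → sum (map (λ _ → k) xs) ≡ length xs * k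
sum-map-const k [] = refl
sum-map-const k (x ∷ xs) = cong (k +_) (sum-map-const k xs)

sum-map-*ʳ : ∀ {A : Set} (f : A → ℕ) K xs → sum (map f xs) * K ≡ sum (map (λ a → f a * K) xs)
sum-map-*ʳ f K [] = refl
sum-map-*ʳ f K (x ∷ xs) = trans (*-distribʳ-+ K (f x) _) (cong (f x * K +_) (sum-map-*ʳ f K xs))

sum-map-*ˡ : ∀ {A : Set} (f : A → ℕ) c xs → c * sum (map f xs) ≡ sum (map (λ a → c * f a) xs)
sum-map-*ˡ f c xs = trans (*-comm c _) (trans (sum-map-*ʳ f c xs) (cong sum (map-cong (λ a → *-comm (f a) c) xs)))

sum-map-𝟙-*₄ : ∀ {A : Set} (p₁ p₂ p₃ p₄ : A → Bool) X₁ X₂ X₃ X₄ xs →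
  sum (map (λ a → 𝟙 (p₁ a) * X₁ + 𝟙 (p₂ a) * X₂ + 𝟙 (p₃ a) * X₃ + 𝟙 (p₄ a) * X₄) xs)
    ≡ countᵇ p₁ xs * X₁ + countᵇ p₂ xs * X₂ + countᵇ p₃ xs * X₃ + countᵇ p₄ xs * X₄
sum-map-𝟙-*₄ p₁ p₂ p₃ p₄ X₁ X₂ X₃ X₄ [] = refl
sum-map-𝟙-*₄ p₁ p₂ p₃ p₄ X₁ X₂ X₃ X₄ (a ∷ xs) rewrite sum-map-𝟙-*₄ p₁ p₂ p₃ p₄ X₁ X₂ X₃ X₄ xs =
  regroup (𝟙 (p₁ a)) (𝟙 (p₂ a)) (𝟙 (p₃ a)) (𝟙 (p₄ a)) (countᵇ p₁ xs) (countᵇ p₂ xs) (countᵇ p₃ xs) (countᵇ p₄ xs) X₁ X₂ X₃ X₄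
  where
  regroup : ∀ i₁ i₂ i₃ i₄ c₁ c₂ c₃ c₄ X₁ X₂ X₃ X₄ →
    i₁ * X₁ + i₂ * X₂ + i₃ * X₃ + i₄ * X₄ + (c₁ * X₁ + c₂ * X₂ + c₃ * X₃ + c₄ * X₄)
      ≡ (i₁ + c₁) * X₁ + (i₂ + c₂) * X₂ + (i₃ + c₃) * X₃ + (i₄ + c₄) * X₄
  regroup = solve-∀

≤-summand₁ : ∀ (i₁ i₂ i₃ i₄ : Bool) X₁ X₂ X₃ X₄ → i₁ ≡ true → X₁ ≤ 𝟙 i₁ * X₁ + 𝟙 i₂ * X₂ + 𝟙 i₃ * X₃ + 𝟙 i₄ * X₄
≤-summand₁ .true i₂ i₃ i₄ X₁ X₂ X₃ X₄ refl = ≤-trans (≤-reflexive (sym (*-identityˡ X₁)))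
  (≤-trans (m≤m+n (1 * X₁) (𝟙 i₂ * X₂)) (≤-trans (m≤m+n (1 * X₁ + 𝟙 i₂ * X₂) (𝟙 i₃ * X₃)) (m≤m+n (1 * X₁ + 𝟙 i₂ * X₂ + 𝟙 i₃ * X₃) (𝟙 i₄ * X₄))))

≤-summand₂ : ∀ (i₁ i₂ i₃ i₄ : Bool) X₁ X₂ X₃ X₄ → i₂ ≡ true → X₂ ≤ 𝟙 i₁ * X₁ + 𝟙 i₂ * X₂ + 𝟙 i₃ * X₃ + 𝟙 i₄ * X₄
≤-summand₂ i₁ .true i₃ i₄ X₁ X₂ X₃ X₄ refl = ≤-trans (≤-reflexive (sym (*-identityˡ X₂)))
  (≤-trans (m≤n+m (1 * X₂) (𝟙 i₁ * X₁)) (≤-trans (m≤m+n (𝟙 i₁ * X₁ + 1 * X₂) (𝟙 i₃ * X₃)) (m≤m+n (𝟙 i₁ * X₁ + 1 * X₂ + 𝟙 i₃ * X₃) (𝟙 i₄ * X₄))))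

≤-summand₃ : ∀ (i₁ i₂ i₃ i₄ : Bool) X₁ X₂ X₃ X₄ → i₃ ≡ true → X₃ ≤ 𝟙 i₁ * X₁ + 𝟙 i₂ * X₂ + 𝟙 i₃ * X₃ + 𝟙 i₄ * X₄
≤-summand₃ i₁ i₂ .true i₄ X₁ X₂ X₃ X₄ refl = ≤-trans (≤-reflexive (sym (*-identityˡ X₃)))
  (≤-trans (m≤n+m (1 * X₃) (𝟙 i₁ * X₁ + 𝟙 i₂ * X₂)) (m≤m+n (𝟙 i₁ * X₁ + 𝟙 i₂ * X₂ + 1 * X₃) (𝟙 i₄ * X₄)))

≤-summand₄ : ∀ (i₁ i₂ i₃ i₄ : Bool) X₁ X₂ X₃ X₄ → i₄ ≡ true → X₄ ≤ 𝟙 i₁ * X₁ + 𝟙 i₂ * X₂ + 𝟙 i₃ * X₃ + 𝟙 i₄ * X₄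
≤-summand₄ i₁ i₂ i₃ .true X₁ X₂ X₃ X₄ refl = ≤-trans (≤-reflexive (sym (*-identityˡ X₄)))
  (m≤n+m (1 * X₄) (𝟙 i₁ * X₁ + 𝟙 i₂ * X₂ + 𝟙 i₃ * X₃))

sum-map-swap : ∀ {A B : Set} (f : A → B → ℕ) xs ys → sum (map (λ a → sum (map (λ b → f a b) ys)) xs) ≡ sum (map (λ b → sum (map (λ a → f a b) xs)) ys)
sum-map-swap f [] ys = sym (z ys)
  where
  z : ∀ ys → sum (map (λ b → 0) ys) ≡ 0
  z [] = refl
  z (_ ∷ ys) = z ys
sum-map-swap f (x ∷ xs) ys = trans (cong (sum (map (λ b → f x b) ys) +_) (sum-map-swap f xs ys)) (sym (sum-map-+ (λ b → f x b) (λ b → sum (map (λ a → f a b) xs)) ys))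

length-concatMap : ∀ {A B : Set} (f : A → List B) xs → length (concatMap f xs) ≡ sum (map (λ a → length (f a)) xs)
length-concatMap f [] = refl
length-concatMap f (x ∷ xs) = trans (length-++ (f x)) (cong (length (f x) +_) (length-concatMap f xs))

oneTo : ℕ → List ℕ
oneTo zero = []
oneTo (suc d) = suc d ∷ oneTo d

∈-oneTo : ∀ k d → 1 ≤ k → k ≤ d → k ∈ oneTo d
∈-oneTo (suc k) (suc d) _ h with k ≟ d
... | yes refl = here refl
... | no ne = there (∈-oneTo (suc k) d (s≤s z≤n) (≤∧≢⇒< (s≤s⁻¹ h) ne))

oneTo-∈ : ∀ k d → k ∈ oneTo d → 1 ≤ k × k ≤ d
oneTo-∈ .(suc d) (suc d) (here refl) = s≤s z≤n , ≤-refl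
oneTo-∈ k (suc d) (there m) with oneTo-∈ k d m
... | a , b = a , m≤n⇒m≤1+n b


sumFin : ∀ n → (Fin n → ℕ) → ℕ
sumFin zero g = 0
sumFin (suc n) g = g zero + sumFin n (λ i → g (suc i))

sum-map-tabulate : ∀ {A : Set} n (g : A → ℕ) (f : Fin n → A) → sum (map g (tabulate f)) ≡ sumFin n (λ i → g (f i))
sum-map-tabulate zero g f = refl
sum-map-tabulate (suc n) g f = cong (g (f zero) +_) (sum-map-tabulate n g (λ i → f (suc i)))

sum-map-allFin : ∀ n (g : Fin n → ℕ) → sum (map g (allFinL n)) ≡ sumFin n g
sum-map-allFin n g = sum-map-tabulate n g (λ i → i)

sumFin-cong : ∀ n (f g : Fin n → ℕ) → (∀ i → f i ≡ g i) → sumFin n f ≡ sumFin n g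
sumFin-cong zero f g h = refl
sumFin-cong (suc n) f g h = cong₂ _+_ (h zero) (sumFin-cong n _ _ (λ i → h (suc i)))

sumFin-mono : ∀ n (f g : Fin n → ℕ) → (∀ i → f i ≤ g i) → sumFin n f ≤ sumFin n g
sumFin-mono zero f g h = z≤n
sumFin-mono (suc n) f g h = +-mono-≤ (h zero) (sumFin-mono n _ _ (λ i → h (suc i)))

sumFin-zero : ∀ n → sumFin n (λ _ → 0) ≡ 0
sumFin-zero zero = refl
sumFin-zero (suc n) = sumFin-zero n

sumFin-const : ∀ n c → sumFin n (λ _ → c) ≡ n * c
sumFin-const zero c = refl
sumFin-const (suc n) c = cong (c +_) (sumFin-const n c)

sumFin-+ : ∀ n (f g : Fin n → ℕ) → sumFin n (λ i → f i + g i) ≡ sumFin n f + sumFin n g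
sumFin-+ zero f g = refl
sumFin-+ (suc n) f g rewrite sumFin-+ n (λ i → f (suc i)) (λ i → g (suc i)) = interchange (f zero) (g zero) _ _

sumFin-*ˡ : ∀ n c (f : Fin n → ℕ) → sumFin n (λ i → c * f i) ≡ c * sumFin n f
sumFin-*ˡ zero c f = sym (*-zeroʳ c)
sumFin-*ˡ (suc n) c f rewrite sumFin-*ˡ n c (λ i → f (suc i)) = sym (*-distribˡ-+ c (f zero) _)

sumFin-𝟙-== : ∀ n (x : Fin n) → sumFin n (λ k → 𝟙 (k == x)) ≡ 1
sumFin-𝟙-== (suc n) zero = cong suc (sumFin-zero n)
sumFin-𝟙-== (suc n) (suc x) = trans (sumFin-cong n _ _ (λ k → cong 𝟙 (suc==suc k x))) (sumFin-𝟙-== n x)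

sumFin³ : ∀ n → (Fin n → Fin n → Fin n → ℕ) → ℕ
sumFin³ n F = sumFin n λ i → sumFin n λ j → sumFin n λ k → F i j k

sumFin³-+ : ∀ n F G → sumFin³ n (λ i j k → F i j k + G i j k) ≡ sumFin³ n F + sumFin³ n G
sumFin³-+ n F G = trans (sumFin-cong n _ _ (λ i → trans (sumFin-cong n _ _ (λ j → sumFin-+ n (F i j) (G i j))) (sumFin-+ n _ _))) (sumFin-+ n _ _)

sumFin³-* : ∀ n (f g h : Fin n → ℕ) → sumFin³ n (λ i j k → f i * g j * h k) ≡ sumFin n f * sumFin n g * sumFin n h
sumFin³-* n f g h = trans (sumFin-cong n _ _ (λ i → trans (sumFin-cong n _ _ (λ j → sumFin-*ˡ n (f i * g j) h))
   (trans (sumFin-cong n _ _ (λ j → trans (*-assoc (f i) (g j) (sumFin n h)) (cong (f i *_) (*-comm (g j) (sumFin n h)))))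
     (trans (sumFin-*ˡ n (f i) _) (cong (f i *_) (sumFin-*ˡ n (sumFin n h) g))))))
   (trans (sumFin-cong n _ _ (λ i → trans (sym (*-assoc (f i) (sumFin n h) (sumFin n g))) (*-comm (f i * sumFin n h) (sumFin n g))))
   (trans (sumFin-*ˡ n (sumFin n g) (λ i → f i * sumFin n h)) (trans (cong (sumFin n g *_) (trans (sumFin-cong n _ _ (λ i → *-comm (f i) (sumFin n h))) (sumFin-*ˡ n (sumFin n h) f)))
     (identity (sumFin n f) (sumFin n g) (sumFin n h)))))
  where
  identity : ∀ a b c → b * (c * a) ≡ a * b * c
  identity = solve-∀


-- Arithmetic

^-distribʳ-* : ∀ x y k → (x * y) ^ k ≡ x ^ k * y ^ k
^-distribʳ-* x y zero = refl
^-distribʳ-* x y (suc k) rewrite ^-distribʳ-* x y k = identity x y (x ^ k) (y ^ k)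
  where
  identity : ∀ x y a b → x * y * (a * b) ≡ x * a * (y * b)
  identity = solve-∀

^-monoˡ-≤⁻¹ : ∀ k x y → 1 ≤ k → x ^ k ≤ y ^ k → x ≤ y
^-monoˡ-≤⁻¹ (suc k) x y _ h with x ≤? y
... | yes p = p
... | no np = ⊥-elim (<⇒≱ (^-monoˡ-< (suc k) (≰⇒> np)) h)

1≤m⇒1≤m^n : ∀ x k → 1 ≤ x → 1 ≤ x ^ k
1≤m⇒1≤m^n x zero h = ≤-refl
1≤m⇒1≤m^n x (suc k) h = *-mono-≤ h (1≤m⇒1≤m^n x k h)

*-cancelʳ-≤′ : ∀ a b c → 1 ≤ c → a * c ≤ b * c → a ≤ b
*-cancelʳ-≤′ a b (suc c) _ h = *-cancelʳ-≤ a b (suc c) h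

^-monoʳ-≤′ : ∀ x {a b} → 1 ≤ x → a ≤ b → x ^ a ≤ x ^ b
^-monoʳ-≤′ (suc x) h ab = ^-monoʳ-≤ (suc x) ab

bernoulli : ∀ k Q β → Q ^ k + k * (β * Q ^ (k ∸ 1)) ≤ (Q + β) ^ k
bernoulli zero Q β = ≤-refl
bernoulli (suc zero) Q β = ≤-reflexive (identity Q β)
  where
  identity : ∀ Q β → Q * 1 + 1 * (β * 1) ≡ (Q + β) * 1
  identity = solve-∀
bernoulli (suc (suc k)) Q β = begin
  Q ^ suc (suc k) + suc (suc k) * (β * Q ^ suc k) ≤⟨ m≤m+n _ (β * (suc k * (β * Q ^ k))) ⟩
  Q ^ suc (suc k) + suc (suc k) * (β * Q ^ suc k) + β * (suc k * (β * Q ^ k)) ≡⟨ sym (identity Q β (Q ^ k) k) ⟩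
  (Q + β) * (Q ^ suc k + suc k * (β * Q ^ k)) ≤⟨ *-monoʳ-≤ (Q + β) (bernoulli (suc k) Q β) ⟩
  (Q + β) ^ suc (suc k) ∎
  where
  open ≤-Reasoning
  identity : ∀ Q β A k → (Q + β) * (Q * A + suc k * (β * A)) ≡ (Q * (Q * A) + suc (suc k) * (β * (Q * A))) + β * (suc k * (β * A))
  identity = solve-∀

bernoulli-shift : ∀ d j → suc (d + j) ^ j * suc d ≤ suc (d + j) * (d + j) ^ j
bernoulli-shift d zero = ≤-reflexive (trans (*-identityˡ (suc d)) (trans (cong suc (sym (+-identityʳ d))) (sym (*-identityʳ _))))
bernoulli-shift d (suc j) = begin
  r * r ^ j * suc d ≡⟨ *-assoc r (r ^ j) (suc d) ⟩
  r * (r ^ j * suc d) ≡⟨ cong (r *_) (*-comm (r ^ j) (suc d)) ⟩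
  r * (suc d * r ^ j) ≡⟨ sym (*-assoc r (suc d) (r ^ j)) ⟩
  r * suc d * r ^ j ≤⟨ *-monoˡ-≤ (r ^ j) key ⟩
  r' * suc (suc d) * r ^ j ≡⟨ identity r' (suc (suc d)) (r ^ j) ⟩
  r' * (r ^ j * suc (suc d)) ≤⟨ *-monoʳ-≤ r' ih ⟩
  r' * (r * r' ^ j) ≡⟨ identity₂ r' r (r' ^ j) ⟩
  r * (r' * r' ^ j) ∎
  where
  open ≤-Reasoning
  r' = d + suc j
  r = suc r'
  e : suc d + j ≡ d + suc j
  e = sym (+-suc d j)
  ih : r ^ j * suc (suc d) ≤ r * r' ^ j
  ih = subst (λ z → suc z ^ j * suc (suc d) ≤ suc z * z ^ j) e (bernoulli-shift (suc d) j)
  key : r * suc d ≤ r' * suc (suc d)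
  key = subst₂ _≤_ (identity₃ d j) (identity₄ d j) (+-monoʳ-≤ (d * d + d * suc j + d + suc j) (s≤s (m≤m+n d j)))
    where
    identity₃ : ∀ d j → d * d + d * suc j + d + suc j + suc d ≡ suc (d + suc j) * suc d
    identity₃ = solve-∀
    identity₄ : ∀ d j → d * d + d * suc j + d + suc j + suc (d + j) ≡ (d + suc j) * suc (suc d)
    identity₄ = solve-∀
  identity : ∀ a b c → a * b * c ≡ a * (c * b)
  identity = solve-∀
  identity₂ : ∀ a b c → a * (b * c) ≡ b * (a * c)
  identity₂ = solve-∀

suc≤2^ : ∀ i → suc i ≤ 2 ^ i
suc≤2^ zero = ≤-refl
suc≤2^ (suc i) = ≤-trans (s≤s (m≤n+m (suc i) i)) (≤-trans (+-mono-≤ (suc≤2^ i) (suc≤2^ i)) (≤-reflexive (cong (2 ^ i +_) (sym (+-identityʳ (2 ^ i))))))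

m<[1+m/n]*n : ∀ m n .{{_ : NonZero n}} → m < suc (m / n) * n
m<[1+m/n]*n m n = begin-strict
  m                 ≡⟨ m≡m%n+[m/n]*n m n ⟩
  m % n + m / n * n <⟨ +-monoˡ-< (m / n * n) (m%n<n m n) ⟩
  n + m / n * n     ∎
  where open ≤-Reasoning

suc[/]^≤2^ : ∀ j r .{{_ : NonZero r}} → suc (j / r) ^ r ≤ 2 ^ j
suc[/]^≤2^ j r = begin
  suc (j / r) ^ r ≤⟨ ^-monoˡ-≤ r (suc≤2^ (j / r)) ⟩
  (2 ^ (j / r)) ^ r ≡⟨ ^-*-assoc 2 (j / r) r ⟩
  2 ^ (j / r * r) ≤⟨ ^-monoʳ-≤′ 2 (s≤s z≤n) (m/n*n≤m j r) ⟩
  2 ^ j ∎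
  where open ≤-Reasoning


-- Counting formulas and clauses

countF-mono : ∀ n m (P Q : Formula n m → Bool) → (∀ v → P v ≡ true → Q v ≡ true) →
  countF n m P ≤ countF n m Q
countF-mono n zero P Q h with P [] in eq
... | true rewrite h [] eq = ≤-refl
... | false = z≤n
countF-mono n (suc m) P Q h =
  sum-map-mono _ _ (allClauses n) (λ c → countF-mono n m _ _ (λ v → h (c ∷ v)))

countF-∨ : ∀ n m (P Q : Formula n m → Bool) →
  countF n m (λ v → P v ∨ Q v) ≤ countF n m P + countF n m Q
countF-∨ n zero P Q with P [] | Q []
... | true | true = s≤s z≤n
... | true | false = ≤-refl
... | false | true = ≤-refl
... | false | false = ≤-refl
countF-∨ n (suc m) P Q = ≤-trans
  (sum-map-mono _ _ (allClauses n) (λ c → countF-∨ n m (λ v → P (c ∷ v)) (λ v → Q (c ∷ v))))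
  (≤-reflexive (sum-map-+ _ _ (allClauses n)))

countF-false : ∀ n m (P : Formula n m → Bool) → (∀ v → P v ≡ false) → countF n m P ≡ 0
countF-false n zero P h rewrite h [] = refl
countF-false n (suc m) P h = go (allClauses n)
  where
  go : ∀ cs → sum (map (λ c → countF n m (λ v → P (c ∷ v))) cs) ≡ 0
  go [] = refl
  go (c ∷ cs) rewrite countF-false n m (λ v → P (c ∷ v)) (λ v → h (c ∷ v)) = go cs

countF-never : ∀ n m (P : Formula n m → Bool) → (∀ v → P v ≡ true → ⊥) → countF n m P ≡ 0
countF-never n m P h = countF-false n m P (λ v → ¬-not (h v))

countF-any : ∀ {A : Set} n m (P : A → Formula n m → Bool) (xs : List A) →
  countF n m (λ v → any (λ a → P a v) xs) ≤ sum (map (λ a → countF n m (P a)) xs)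
countF-any n m P [] = ≤-reflexive (countF-false n m _ (λ v → refl))
countF-any n m P (x ∷ xs) = ≤-trans (countF-∨ n m (P x) (λ v → any (λ a → P a v) xs))
  (+-monoʳ-≤ (countF n m (P x)) (countF-any n m P xs))

countF-true : ∀ n m → countF n m (λ _ → true) ≡ length (allClauses n) ^ m
countF-true n zero = refl
countF-true n (suc m) rewrite countF-true n m | sum-map-const (length (allClauses n) ^ m) (allClauses n) = refl


ascending : ∀ {n} → Fin n → Fin n → Fin n → Bool
ascending i j k = (toℕ i <ᵇ toℕ j) ∧ (toℕ j <ᵇ toℕ k)

sumAsc³ : ∀ n → (Fin n → Fin n → Fin n → ℕ) → ℕ
sumAsc³ n F = sumFin n λ i → sumFin n λ j → sumFin n λ k → 𝟙 (ascending i j k) * F i j k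

sumAsc² : ∀ n → (Fin n → Fin n → ℕ) → ℕ
sumAsc² n V = sumFin n λ j → sumFin n λ k → 𝟙 (toℕ j <ᵇ toℕ k) * V j k

signedClauses : ∀ {n} → Fin n → Fin n → Fin n → List (Clause n)
signedClauses i j k = map (λ { (s , t , u) → ((i , s) , (j , t) , (k , u)) }) signPatterns

clausesOn : ∀ {n} → Fin n → Fin n → Fin n → List (Clause n)
clausesOn i j k = if ascending i j k then signedClauses i j k else []

countᵇ-allClauses : ∀ n (P : Clause n → Bool) → countᵇ P (allClauses n) ≡ sumAsc³ n (λ i j k → countᵇ P (signedClauses i j k))
countᵇ-allClauses n P = begin
  countᵇ P (allClauses n) ≡⟨ countᵇ-concatMap P _ (allFinL n) ⟩
  sum (map (λ i → countᵇ P (concatMap (λ j → concatMap (λ k → clausesOn i j k) (allFinL n)) (allFinL n))) (allFinL n))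
    ≡⟨ sum-map-allFin n _ ⟩
  sumFin n (λ i → countᵇ P (concatMap (λ j → concatMap (λ k → clausesOn i j k) (allFinL n)) (allFinL n)))
    ≡⟨ sumFin-cong n _ _ (λ i → trans (countᵇ-concatMap P _ (allFinL n)) (trans (sum-map-allFin n _)
        (sumFin-cong n _ _ (λ j → trans (countᵇ-concatMap P _ (allFinL n)) (trans (sum-map-allFin n _)
          (sumFin-cong n _ _ (λ k → countᵇ-if P (ascending i j k) (signedClauses i j k)))))))) ⟩
  sumAsc³ n (λ i j k → countᵇ P (signedClauses i j k)) ∎
  where open ≡-Reasoning

sumAsc³-suc : ∀ n F → sumAsc³ (suc n) F ≡ sumAsc³ n (λ i j k → F (suc i) (suc j) (suc k)) + sumAsc² n (λ j k → F zero (suc j) (suc k))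
sumAsc³-suc n F = begin
  sumAsc³ (suc n) F ≡⟨ cong₂ _+_ Az (sumFin-cong n _ _ As) ⟩
  sumAsc² n (λ j k → F zero (suc j) (suc k)) + sumAsc³ n (λ i j k → F (suc i) (suc j) (suc k))
    ≡⟨ +-comm (sumAsc² n (λ j k → F zero (suc j) (suc k))) _ ⟩
  _ ∎
  where
  open ≡-Reasoning
  Az : (sumFin (suc n) λ j → sumFin (suc n) λ k → 𝟙 (ascending {suc n} zero j k) * F zero j k) ≡ sumAsc² n (λ j k → F zero (suc j) (suc k))
  Az = cong (_+ sumAsc² n (λ j k → F zero (suc j) (suc k))) (sumFin-zero (suc n))
  As : ∀ i → (sumFin (suc n) λ j → sumFin (suc n) λ k → 𝟙 (ascending (suc i) j k) * F (suc i) j k) ≡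
             (sumFin n λ j → sumFin n λ k → 𝟙 (ascending i j k) * F (suc i) (suc j) (suc k))
  As i = trans (cong (λ z → z + (sumFin n λ j → sumFin (suc n) λ k → 𝟙 (ascending (suc i) (suc j) k) * F (suc i) (suc j) k)) (sumFin-zero (suc n)))
    (sumFin-cong n _ _ (λ j → cong (λ z → z + (sumFin n λ k → 𝟙 (ascending i j k) * F (suc i) (suc j) (suc k))) (𝟙-∧false-* (toℕ i <ᵇ toℕ j) (F (suc i) (suc j) zero))))

sumAsc²-suc : ∀ n V → sumAsc² (suc n) V ≡ sumAsc² n (λ j k → V (suc j) (suc k)) + sumFin n (λ k → V zero (suc k))
sumAsc²-suc n V = trans (cong (λ z → z + sumAsc² n (λ j k → V (suc j) (suc k))) (sumFin-cong n (λ k → 𝟙 true * V zero (suc k)) _ (λ k → *-identityˡ (V zero (suc k))))) (+-comm (sumFin n (λ k → V zero (suc k))) _)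

sumAsc²-cong : ∀ n (V V' : Fin n → Fin n → ℕ) → (∀ j k → V j k ≡ V' j k) → sumAsc² n V ≡ sumAsc² n V'
sumAsc²-cong n V V' h = sumFin-cong n _ _ (λ j → sumFin-cong n _ _ (λ k → cong (𝟙 (toℕ j <ᵇ toℕ k) *_) (h j k)))

sumAsc³-cong : ∀ n (F G : Fin n → Fin n → Fin n → ℕ) → (∀ i j k → F i j k ≡ G i j k) → sumAsc³ n F ≡ sumAsc³ n G
sumAsc³-cong n F G h = sumFin-cong n _ _ (λ i → sumFin-cong n _ _ (λ j → sumFin-cong n _ _ (λ k → cong (𝟙 (ascending i j k) *_) (h i j k))))

sumAsc²-zero : ∀ n (V : Fin n → Fin n → ℕ) → (∀ j k → V j k ≡ 0) → sumAsc² n V ≡ 0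
sumAsc²-zero n V h = trans (sumAsc²-cong n V (λ _ _ → 0) h) (trans (sumFin-cong n _ _ (λ j → trans (sumFin-cong n _ _ (λ k → *-zeroʳ (𝟙 (toℕ j <ᵇ toℕ k)))) (sumFin-zero n))) (sumFin-zero n))

sumAsc³-zero : ∀ n (F : Fin n → Fin n → Fin n → ℕ) → (∀ i j k → F i j k ≡ 0) → sumAsc³ n F ≡ 0
sumAsc³-zero n F h = trans (sumAsc³-cong n F (λ _ _ _ → 0) h) (trans (sumFin-cong n _ _ (λ i → trans (sumFin-cong n _ _ (λ j → trans (sumFin-cong n _ _ (λ k → *-zeroʳ (𝟙 (ascending i j k)))) (sumFin-zero n))) (sumFin-zero n))) (sumFin-zero n))

choose2 : ℕ → ℕ
choose2 n = sumAsc² n (λ _ _ → 1)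

choose3 : ℕ → ℕ
choose3 n = sumAsc³ n (λ _ _ _ → 1)

choose2-suc : ∀ n → choose2 (suc n) ≡ choose2 n + n
choose2-suc n = trans (sumAsc²-suc n (λ _ _ → 1)) (cong (choose2 n +_) (trans (sumFin-const n 1) (*-identityʳ n)))

choose3-suc : ∀ n → choose3 (suc n) ≡ choose3 n + choose2 n
choose3-suc n = sumAsc³-suc n (λ _ _ _ → 1)

choose2-closed : ∀ n → 2 * choose2 n + n ≡ n * n
choose2-closed zero = refl
choose2-closed (suc n) rewrite choose2-suc n = begin
  2 * (choose2 n + n) + suc n ≡⟨ identity₁ (choose2 n) n ⟩
  (2 * choose2 n + n) + 2 * n + 1 ≡⟨ cong (λ z → z + 2 * n + 1) (choose2-closed n) ⟩
  n * n + 2 * n + 1 ≡⟨ identity₂ n ⟩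
  suc n * suc n ∎
  where
  open ≡-Reasoning
  identity₁ : ∀ a n → 2 * (a + n) + suc n ≡ (2 * a + n) + 2 * n + 1
  identity₁ = solve-∀
  identity₂ : ∀ n → n * n + 2 * n + 1 ≡ suc n * suc n
  identity₂ = solve-∀

choose3-closed : ∀ n → 6 * choose3 n + 3 * (n * n) ≡ n * n * n + 2 * n
choose3-closed zero = refl
choose3-closed (suc n) rewrite choose3-suc n = begin
  6 * (choose3 n + choose2 n) + 3 * (suc n * suc n) ≡⟨ identity₁ (choose3 n) (choose2 n) n ⟩
  (6 * choose3 n + 3 * (n * n)) + 3 * (2 * choose2 n + n) + 3 * n + 3 ≡⟨ cong₂ (λ a b → a + 3 * b + 3 * n + 3) (choose3-closed n) (choose2-closed n) ⟩
  (n * n * n + 2 * n) + 3 * (n * n) + 3 * n + 3 ≡⟨ identity₂ n ⟩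
  suc n * suc n * suc n + 2 * suc n ∎
  where
  open ≡-Reasoning
  identity₁ : ∀ a b n → 6 * (a + b) + 3 * (suc n * suc n) ≡ (6 * a + 3 * (n * n)) + 3 * (2 * b + n) + 3 * n + 3
  identity₁ = solve-∀
  identity₂ : ∀ n → (n * n * n + 2 * n) + 3 * (n * n) + 3 * n + 3 ≡ suc n * suc n * suc n + 2 * suc n
  identity₂ = solve-∀

hits² : ∀ {n} → Fin n → Fin n → Fin n → ℕ
hits² x j k = 𝟙 (j == x) + 𝟙 (k == x)

hits³ : ∀ {n} → Fin n → Fin n → Fin n → Fin n → ℕ
hits³ x i j k = 𝟙 (i == x) + 𝟙 (j == x) + 𝟙 (k == x)

sumAsc²-hits : ∀ n (x : Fin (suc n)) → sumAsc² (suc n) (hits² x) ≡ n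
sumAsc²-hits n zero = trans (sumAsc²-suc n (hits² zero)) (trans (cong₂ _+_ (sumAsc²-zero n _ (λ j k → refl)) (trans (sumFin-const n 1) (*-identityʳ n))) refl)
sumAsc²-hits (suc n) (suc x) = trans (sumAsc²-suc (suc n) (hits² (suc x))) (trans (cong₂ _+_
   (trans (sumAsc²-cong (suc n) _ (hits² x) (λ j k → cong₂ _+_ (cong 𝟙 (suc==suc j x)) (cong 𝟙 (suc==suc k x)))) (sumAsc²-hits n x))
   (trans (sumFin-cong (suc n) _ _ (λ k → cong 𝟙 (suc==suc k x))) (sumFin-𝟙-== (suc n) x))) (+-comm n 1))

sumAsc³-hits : ∀ n (x : Fin (suc n)) → sumAsc³ (suc n) (hits³ x) ≡ choose2 n
sumAsc³-hits n zero = trans (sumAsc³-suc n (hits³ zero)) (cong₂ _+_ (sumAsc³-zero n _ (λ i j k → refl)) refl)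
sumAsc³-hits (suc n) (suc x) = trans (sumAsc³-suc (suc n) (hits³ (suc x)))
  (trans (cong₂ _+_ (trans (sumAsc³-cong (suc n) _ (hits³ x) (λ i j k → cong₂ _+_ (cong₂ _+_ (cong 𝟙 (suc==suc i x)) (cong 𝟙 (suc==suc j x))) (cong 𝟙 (suc==suc k x)))) (sumAsc³-hits n x))
      (sumAsc²-cong (suc n) _ (hits² x) (λ j k → cong₂ _+_ (cong 𝟙 (suc==suc j x)) (cong 𝟙 (suc==suc k x)))))
  (trans (cong (choose2 n +_) (sumAsc²-hits n x)) (sym (choose2-suc n))))


posPMM : ∀ {n} → Fin n → Clause n → Bool
posPMM x c = isPMM c ∧ posIn x c

covers : ∀ {n} → Fin n × Fin n → Clause n → Bool
covers (u , w) c = not (u == w) ∧ (occIn u c ∧ occIn w c)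

countᵇ-posPMM-signedClauses : ∀ {n} (x i j k : Fin n) → countᵇ (posPMM x) (signedClauses i j k) ≡ hits³ x i j k
countᵇ-posPMM-signedClauses x i j k with i == x | j == x | k == x
... | true | true | true = refl
... | true | true | false = refl
... | true | false | true = refl
... | true | false | false = refl
... | false | true | true = refl
... | false | true | false = refl
... | false | false | true = refl
... | false | false | false = refl

sumAsc³-*ˡ : ∀ n c F → sumAsc³ n (λ i j k → c * F i j k) ≡ c * sumAsc³ n F
sumAsc³-*ˡ n c F = trans (sumFin-cong n _ _ (λ i → trans (sumFin-cong n _ _ (λ j →
     trans (sumFin-cong n _ _ (λ k → x∙yz≈y∙xz (𝟙 (ascending i j k)) c (F i j k))) (sumFin-*ˡ n c _))) (sumFin-*ˡ n c _))) (sumFin-*ˡ n c _)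

length-allClauses : ∀ n → length (allClauses n) ≡ 7 * choose3 n
length-allClauses n = trans (sym (countᵇ-true (allClauses n))) (trans (countᵇ-allClauses n (λ _ → true))
  (sumAsc³-*ˡ n 7 (λ _ _ _ → 1)))

countᵇ-posPMM-allClauses : ∀ n (x : Fin (suc n)) → countᵇ (posPMM x) (allClauses (suc n)) ≡ choose2 n
countᵇ-posPMM-allClauses n x = trans (countᵇ-allClauses (suc n) (posPMM x)) (trans (sumAsc³-cong (suc n) _ _ (countᵇ-posPMM-signedClauses x)) (sumAsc³-hits n x))

posPMM-disjoint : ∀ {n} (x y : Fin n) → (x == y) ≡ false → ∀ c → posPMM x c ∧ posPMM y c ≡ false
posPMM-disjoint x y h ((v1 , true) , (v2 , false) , (v3 , false))
  rewrite ∧-identityʳ (v1 == x) | ∧-identityʳ (v1 == y) | ∧-zeroʳ (v2 == x) | ∧-zeroʳ (v2 == y)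
        | ∧-zeroʳ (v3 == x) | ∧-zeroʳ (v3 == y) | ∨-identityʳ (v1 == x) | ∨-identityʳ (v1 == y) = ==-both-false x y v1 h
posPMM-disjoint x y h ((v1 , false) , (v2 , true) , (v3 , false))
  rewrite ∧-identityʳ (v2 == x) | ∧-identityʳ (v2 == y) | ∧-zeroʳ (v1 == x) | ∧-zeroʳ (v1 == y)
        | ∧-zeroʳ (v3 == x) | ∧-zeroʳ (v3 == y) | ∨-identityʳ (v2 == x) | ∨-identityʳ (v2 == y) = ==-both-false x y v2 h
posPMM-disjoint x y h ((v1 , false) , (v2 , false) , (v3 , true))
  rewrite ∧-identityʳ (v3 == x) | ∧-identityʳ (v3 == y) | ∧-zeroʳ (v2 == x) | ∧-zeroʳ (v2 == y)
        | ∧-zeroʳ (v1 == x) | ∧-zeroʳ (v1 == y) | ∨-identityʳ (v3 == x) | ∨-identityʳ (v3 == y) = ==-both-false x y v3 h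
posPMM-disjoint x y h ((v1 , true) , (v2 , true) , (v3 , s3)) = refl
posPMM-disjoint x y h ((v1 , true) , (v2 , false) , (v3 , true)) = refl
posPMM-disjoint x y h ((v1 , false) , (v2 , true) , (v3 , true)) = refl
posPMM-disjoint x y h ((v1 , false) , (v2 , false) , (v3 , false)) = refl

neitherPMM : ∀ {n} → Fin n → Fin n → Clause n → Bool
neitherPMM x y c = not (posPMM x c) ∧ not (posPMM y c)

𝟙-partition : ∀ a b → a ∧ b ≡ false → 𝟙 (not a ∧ not b) + (𝟙 a + 𝟙 b) ≡ 1
𝟙-partition true true ()
𝟙-partition true false e = refl
𝟙-partition false true e = refl
𝟙-partition false false e = refl

countᵇ-partition : ∀ {n} (x y : Fin n) → (x == y) ≡ false → ∀ (xs : List (Clause n)) →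
  countᵇ (neitherPMM x y) xs + (countᵇ (posPMM x) xs + countᵇ (posPMM y) xs) ≡ length xs
countᵇ-partition x y h [] = refl
countᵇ-partition x y h (c ∷ xs) = begin
  𝟙 (neitherPMM x y c) + countᵇ (neitherPMM x y) xs + (𝟙 (posPMM x c) + countᵇ (posPMM x) xs + (𝟙 (posPMM y c) + countᵇ (posPMM y) xs))
    ≡⟨ identity (𝟙 (neitherPMM x y c)) (countᵇ (neitherPMM x y) xs) (𝟙 (posPMM x c)) (countᵇ (posPMM x) xs) (𝟙 (posPMM y c)) (countᵇ (posPMM y) xs) ⟩
  (𝟙 (neitherPMM x y c) + (𝟙 (posPMM x c) + 𝟙 (posPMM y c))) + (countᵇ (neitherPMM x y) xs + (countᵇ (posPMM x) xs + countᵇ (posPMM y) xs))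
    ≡⟨ cong₂ _+_ (𝟙-partition (posPMM x c) (posPMM y c) (posPMM-disjoint x y h c)) (countᵇ-partition x y h xs) ⟩
  suc (length xs) ∎
  where
  open ≡-Reasoning
  identity : ∀ a b c d e f → a + b + (c + d + (e + f)) ≡ (a + (c + e)) + (b + (d + f))
  identity = solve-∀

covers-positions : ∀ d a₁ a₂ a₃ b₁ b₂ b₃ →
  (a₁ ≡ true → b₁ ≡ true → d ≡ true) → (a₂ ≡ true → b₂ ≡ true → d ≡ true) → (a₃ ≡ true → b₃ ≡ true → d ≡ true) →
  𝟙 (not d ∧ ((a₁ ∨ (a₂ ∨ (a₃ ∨ false))) ∧ (b₁ ∨ (b₂ ∨ (b₃ ∨ false))))) ≤
    𝟙 a₁ * 𝟙 b₂ * 1 + 𝟙 b₁ * 𝟙 a₂ * 1 + 𝟙 a₁ * 1 * 𝟙 b₃ + 𝟙 b₁ * 1 * 𝟙 a₃ + 1 * 𝟙 a₂ * 𝟙 b₃ + 1 * 𝟙 b₂ * 𝟙 a₃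
covers-positions true  _     _     _     _     _     _     _  _  _  = z≤n
covers-positions false true  _     _     true  _     _     h₁ _  _  = contradiction (h₁ refl refl) false≢true
covers-positions false true  _     _     false true  _     _  _  _  = s≤s z≤n
covers-positions false true  _     _     false false true  _  _  _  = s≤s z≤n
covers-positions false true  _     _     false false false _  _  _  = z≤n
covers-positions false false true  _     true  _     _     _  _  _  = s≤s z≤n
covers-positions false false true  _     false true  _     _  h₂ _  = contradiction (h₂ refl refl) false≢true
covers-positions false false true  _     false false true  _  _  _  = s≤s z≤n
covers-positions false false true  _     false false false _  _  _  = z≤n
covers-positions false false false true  true  _     _     _  _  _  = s≤s z≤n
covers-positions false false false true  false true  _     _  _  _  = s≤s z≤n
covers-positions false false false true  false false true  _  _  h₃ = contradiction (h₃ refl refl) false≢true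
covers-positions false false false true  false false false _  _  _  = z≤n
covers-positions false false false false _     _     _     _  _  _  = z≤n

occurs³ : ∀ {n} → Fin n → Fin n → Fin n → Fin n → Bool
occurs³ u i j k = (i == u) ∨ ((j == u) ∨ ((k == u) ∨ false))

countᵇ-covers-signedClauses : ∀ {n} (u w i j k : Fin n) → countᵇ (covers (u , w)) (signedClauses i j k) ≡ 7 * 𝟙 (not (u == w) ∧ (occurs³ u i j k ∧ occurs³ w i j k))
countᵇ-covers-signedClauses u w i j k = refl

positionPairs : ∀ {n} → Fin n → Fin n → Fin n → Fin n → Fin n → ℕ
positionPairs u w i j k = 𝟙 (i == u) * 𝟙 (j == w) * 1 + 𝟙 (i == w) * 𝟙 (j == u) * 1 + 𝟙 (i == u) * 1 * 𝟙 (k == w)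
   + 𝟙 (i == w) * 1 * 𝟙 (k == u) + 1 * 𝟙 (j == u) * 𝟙 (k == w) + 1 * 𝟙 (j == w) * 𝟙 (k == u)

covers≤positionPairs : ∀ {n} (u w i j k : Fin n) → 𝟙 (not (u == w) ∧ (occurs³ u i j k ∧ occurs³ w i j k)) ≤ positionPairs u w i j k
covers≤positionPairs u w i j k = covers-positions (u == w) (i == u) (j == u) (k == u) (i == w) (j == w) (k == w)
  (==-trans₂ i u w) (==-trans₂ j u w) (==-trans₂ k u w)

sumAsc³≤sumFin³ : ∀ n F → sumAsc³ n F ≤ sumFin³ n F
sumAsc³≤sumFin³ n F = sumFin-mono n _ _ (λ i → sumFin-mono n _ _ (λ j → sumFin-mono n _ _ (λ k → 𝟙*≤ (ascending i j k) (F i j k))))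
  where
  𝟙*≤ : ∀ b w → 𝟙 b * w ≤ w
  𝟙*≤ true w = ≤-reflexive (+-identityʳ w)
  𝟙*≤ false w = z≤n

countᵇ-covers-allClauses : ∀ n (u w : Fin n) → countᵇ (covers (u , w)) (allClauses n) ≤ 42 * n
countᵇ-covers-allClauses n u w = begin
  countᵇ (covers (u , w)) (allClauses n) ≡⟨ countᵇ-allClauses n _ ⟩
  sumAsc³ n (λ i j k → countᵇ (covers (u , w)) (signedClauses i j k)) ≡⟨ sumAsc³-cong n _ _ (countᵇ-covers-signedClauses u w) ⟩
  sumAsc³ n (λ i j k → 7 * 𝟙 (not (u == w) ∧ (occurs³ u i j k ∧ occurs³ w i j k))) ≡⟨ sumAsc³-*ˡ n 7 _ ⟩
  7 * sumAsc³ n (λ i j k → 𝟙 (not (u == w) ∧ (occurs³ u i j k ∧ occurs³ w i j k))) ≤⟨ *-monoʳ-≤ 7 (sumAsc³≤sumFin³ n _) ⟩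
  7 * sumFin³ n (λ i j k → 𝟙 (not (u == w) ∧ (occurs³ u i j k ∧ occurs³ w i j k))) ≤⟨ *-monoʳ-≤ 7 (sumFin-mono n _ _ (λ i → sumFin-mono n _ _ (λ j → sumFin-mono n _ _ (λ k → covers≤positionPairs u w i j k)))) ⟩
  7 * sumFin³ n (positionPairs u w) ≡⟨ cong (7 *_) six-sum ⟩
  7 * E (sumFin n one) ≡⟨ cong (λ z → 7 * E z) (sumFin-const n 1) ⟩
  7 * E (n * 1) ≡⟨ identity n ⟩
  42 * n ∎
  where
  open ≤-Reasoning
  I : Fin n → Fin n → ℕ
  I a = λ i → 𝟙 (i == a)
  one : Fin n → ℕ
  one = λ _ → 1
  E : ℕ → ℕ
  E s = 1 * 1 * s + 1 * 1 * s + 1 * s * 1 + 1 * s * 1 + s * 1 * 1 + s * 1 * 1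
  six-sum : sumFin³ n (positionPairs u w) ≡ E (sumFin n one)
  e1 = trans (sumFin³-* n (I u) (I w) one) (cong₂ (λ a b → a * b * sumFin n one) (sumFin-𝟙-== n u) (sumFin-𝟙-== n w))
  e2 = trans (sumFin³-* n (I w) (I u) one) (cong₂ (λ a b → a * b * sumFin n one) (sumFin-𝟙-== n w) (sumFin-𝟙-== n u))
  e3 = trans (sumFin³-* n (I u) one (I w)) (cong₂ (λ a b → a * sumFin n one * b) (sumFin-𝟙-== n u) (sumFin-𝟙-== n w))
  e4 = trans (sumFin³-* n (I w) one (I u)) (cong₂ (λ a b → a * sumFin n one * b) (sumFin-𝟙-== n w) (sumFin-𝟙-== n u))
  e5 = trans (sumFin³-* n one (I u) (I w)) (cong₂ (λ a b → sumFin n one * a * b) (sumFin-𝟙-== n u) (sumFin-𝟙-== n w))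
  e6 = trans (sumFin³-* n one (I w) (I u)) (cong₂ (λ a b → sumFin n one * a * b) (sumFin-𝟙-== n w) (sumFin-𝟙-== n u))
  a2 = trans (sumFin³-+ n _ _) (cong₂ _+_ e1 e2)
  a3 = trans (sumFin³-+ n _ _) (cong₂ _+_ a2 e3)
  a4 = trans (sumFin³-+ n _ _) (cong₂ _+_ a3 e4)
  a5 = trans (sumFin³-+ n _ _) (cong₂ _+_ a4 e5)
  six-sum = trans (sumFin³-+ n _ _) (cong₂ _+_ a5 e6)
  identity : ∀ n → 7 * (1 * 1 * (n * 1) + 1 * 1 * (n * 1) + 1 * (n * 1) * 1 + 1 * (n * 1) * 1 + n * 1 * 1 * 1 + n * 1 * 1 * 1) ≡ 42 * n
  identity = solve-∀


module ClauseArithmetic (n' U β R0 T : ℕ) (T≡7*U : T ≡ 7 * U)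
  (choose3-identity : 6 * U + 3 * (suc n' * suc n') ≡ suc n' * suc n' * suc n' + 2 * suc n')
  (B2+n'≡n'*n' : β + β + n' ≡ n' * n') (R0+B2≡T : R0 + (β + β) ≡ T) where
  n = suc n'
  B2 = β + β

  6*choose3≡n*B2 : 6 * U ≡ n * B2
  6*choose3≡n*B2 = +-cancelʳ-≡ (3 * (n * n) + n * n') _ _ (begin
    6 * U + (3 * (n * n) + n * n') ≡⟨ sym (+-assoc (6 * U) _ _) ⟩
    6 * U + 3 * (n * n) + n * n' ≡⟨ cong (_+ n * n') choose3-identity ⟩
    n * n * n + 2 * n + n * n' ≡⟨ identity₁ n' ⟩
    n * (n' * n') + 3 * (n * n) ≡⟨ cong (λ z → n * z + 3 * (n * n)) (sym B2+n'≡n'*n') ⟩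
    n * (B2 + n') + 3 * (n * n) ≡⟨ identity₂ n B2 n' ⟩
    n * B2 + (3 * (n * n) + n * n') ∎)
    where
    open ≡-Reasoning
    identity₁ : ∀ n' → suc n' * suc n' * suc n' + 2 * suc n' + suc n' * n' ≡ suc n' * (n' * n') + 3 * (suc n' * suc n')
    identity₁ = solve-∀
    identity₂ : ∀ n B n' → n * (B + n') + 3 * (n * n) ≡ n * B + (3 * (n * n) + n * n')
    identity₂ = solve-∀

  R0-ratio : 7 * n * R0 ≡ (7 * n' + 1) * T
  R0-ratio = +-cancelʳ-≡ (42 * U) _ _ (begin
    7 * n * R0 + 42 * U ≡⟨ cong (7 * n * R0 +_) (identity₀ U) ⟩
    7 * n * R0 + 7 * (6 * U) ≡⟨ cong (λ z → 7 * n * R0 + 7 * z) 6*choose3≡n*B2 ⟩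
    7 * n * R0 + 7 * (n * B2) ≡⟨ identity₁ n R0 B2 ⟩
    7 * n * (R0 + B2) ≡⟨ cong (7 * n *_) (trans R0+B2≡T T≡7*U) ⟩
    7 * n * (7 * U) ≡⟨ identity₂ n' U ⟩
    (7 * n' + 1) * (7 * U) + 42 * U ≡⟨ cong (λ z → (7 * n' + 1) * z + 42 * U) (sym T≡7*U) ⟩
    (7 * n' + 1) * T + 42 * U ∎)
    where
    open ≡-Reasoning
    identity₀ : ∀ U → 42 * U ≡ 7 * (6 * U)
    identity₀ = solve-∀
    identity₁ : ∀ n R B → 7 * n * R + 7 * (n * B) ≡ 7 * n * (R + B)
    identity₁ = solve-∀
    identity₂ : ∀ n' U → 7 * suc n' * (7 * U) ≡ (7 * n' + 1) * (7 * U) + 42 * U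
    identity₂ = solve-∀

  6*R0≡[7n'+1]*B2 : 6 * R0 ≡ (7 * n' + 1) * B2
  6*R0≡[7n'+1]*B2 = +-cancelʳ-≡ (6 * B2) _ _ (begin
    6 * R0 + 6 * B2 ≡⟨ sym (*-distribˡ-+ 6 R0 B2) ⟩
    6 * (R0 + B2) ≡⟨ cong (6 *_) (trans R0+B2≡T T≡7*U) ⟩
    6 * (7 * U) ≡⟨ identity₁ U ⟩
    7 * (6 * U) ≡⟨ cong (7 *_) 6*choose3≡n*B2 ⟩
    7 * (n * B2) ≡⟨ identity₂ n' B2 ⟩
    (7 * n' + 1) * B2 + 6 * B2 ∎)
    where
    open ≡-Reasoning
    identity₁ : ∀ U → 6 * (7 * U) ≡ 7 * (6 * U)
    identity₁ = solve-∀
    identity₂ : ∀ n' B → 7 * (suc n' * B) ≡ (7 * n' + 1) * B + 6 * B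
    identity₂ = solve-∀

  β≤n² : β ≤ n * n
  β≤n² = ≤-trans (m≤m+n β β) (≤-trans (m≤m+n B2 n') (≤-trans (≤-reflexive B2+n'≡n'*n') (*-mono-≤ (n≤1+n n') (n≤1+n n'))))

  -- For n' = 26 + s, 6R0 - 6n³ is a polynomial in s with nonnegative coefficients.
  n³≤R0 : 26 ≤ n' → n * n * n ≤ R0
  n³≤R0 h = go _ (m≤n⇒∃[o]m+o≡n h) B2+n'≡n'*n' 6*R0≡[7n'+1]*B2
    where
    go : ∀ n' → (∃ λ s → 26 + s ≡ n') → B2 + n' ≡ n' * n' → 6 * R0 ≡ (7 * n' + 1) * B2 → suc n' * suc n' * suc n' ≤ R0
    go .(26 + s) (s , refl) B2+n'≡n'*n'′ 6*R0≡[7n'+1]*B2′ = *-cancelˡ-≤ 6 (begin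
      6 * (N * N * N) ≤⟨ m≤m+n _ (s * s * s + 54 * (s * s) + 761 * s + 852) ⟩
      6 * (N * N * N) + (s * s * s + 54 * (s * s) + 761 * s + 852) ≡⟨ identity₃ s ⟩
      (7 * (26 + s) + 1) * (s * s + 51 * s + 650) ≡⟨ cong ((7 * (26 + s) + 1) *_) (sym B2eq) ⟩
      (7 * (26 + s) + 1) * B2 ≡⟨ sym 6*R0≡[7n'+1]*B2′ ⟩
      6 * R0 ∎)
      where
      open ≤-Reasoning
      N = suc (26 + s)
      B2eq : B2 ≡ s * s + 51 * s + 650
      B2eq = +-cancelʳ-≡ (26 + s) _ _ (trans B2+n'≡n'*n'′ (identity s))
        where
        identity : ∀ s → (26 + s) * (26 + s) ≡ s * s + 51 * s + 650 + (26 + s)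
        identity = solve-∀
      identity₃ : ∀ s → 6 * (suc (26 + s) * suc (26 + s) * suc (26 + s)) + (s * s * s + 54 * (s * s) + 761 * s + 852) ≡ (7 * (26 + s) + 1) * (s * s + 51 * s + 650)
      identity₃ = solve-∀

module ClauseCounts (t : ℕ) where
  n' : ℕ
  n' = suc t
  n : ℕ
  n = suc n'
  L : List (Clause n)
  L = allClauses n
  T : ℕ
  T = length L
  β : ℕ
  β = choose2 n'
  B2 : ℕ
  B2 = β + β
  R0 : ℕ
  R0 = T ∸ B2

  countᵇ-neitherPMM : ∀ (x y : Fin n) → (x == y) ≡ false → countᵇ (neitherPMM x y) L ≡ R0
  countᵇ-neitherPMM x y e = sym (trans (cong (_∸ B2) (sym h)) (m+n∸n≡m _ B2))
    where
    h : countᵇ (neitherPMM x y) L + B2 ≡ T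
    h = trans (cong (countᵇ (neitherPMM x y) L +_) (sym (cong₂ _+_ (countᵇ-posPMM-allClauses n' x) (countᵇ-posPMM-allClauses n' y)))) (countᵇ-partition x y e L)

  R0+B2≡T : R0 + B2 ≡ T
  R0+B2≡T = trans (cong (_+ B2) (sym (countᵇ-neitherPMM zero (suc zero) refl))) (trans (cong (countᵇ (neitherPMM zero (suc zero)) L +_) (sym (cong₂ _+_ (countᵇ-posPMM-allClauses n' zero) (countᵇ-posPMM-allClauses n' (suc zero))))) (countᵇ-partition zero (suc zero) refl L))

  B2+n'≡n'*n' : B2 + n' ≡ n' * n'
  B2+n'≡n'*n' = trans (cong (λ z → z + n') (cong (β +_) (sym (+-identityʳ β)))) (choose2-closed n')

  T≡7*choose3 : T ≡ 7 * choose3 n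
  T≡7*choose3 = length-allClauses n
  choose3-identity : 6 * choose3 n + 3 * (suc n' * suc n') ≡ suc n' * suc n' * suc n' + 2 * suc n'
  choose3-identity = choose3-closed n

  open ClauseArithmetic n' (choose3 n) β R0 T T≡7*choose3 choose3-identity B2+n'≡n'*n' R0+B2≡T public using (R0-ratio; n³≤R0; β≤n²)


-- Path certificates

Edge : ℕ → Set
Edge n = Fin n × Fin n

allCovered : ∀ {n} → List (Edge n) → List (Clause n) → Bool
allCovered [] cs = true
allCovered (e ∷ E) cs = any (covers e) cs ∧ allCovered E cs

coverCount : ∀ {n} → Clause n → List (Edge n) → ℕ
coverCount c E = countᵇ (λ e → covers e c) E

noDoubleCover : ∀ {n} → List (Edge n) → List (Clause n) → Bool
noDoubleCover E [] = true
noDoubleCover E (c ∷ cs) = (coverCount c E ≤ᵇ 1) ∧ noDoubleCover E cs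

PathEvent : ∀ {n m} → Fin n → Fin n → ℕ → ℕ → List (Edge n) → Formula n m → Bool
PathEvent x y a b E v = (posPMMCount v x ≤ᵇ a) ∧ ((posPMMCount v y ≤ᵇ b) ∧ (allCovered E (toList v) ∧ noDoubleCover E (toList v)))

posPMMCount-∷ : ∀ {n m} (x : Fin n) (c : Clause n) (v : Formula n m) → posPMMCount (c ∷ v) x ≡ 𝟙 (posPMM x c) + posPMMCount v x
posPMMCount-∷ x c v with posPMM x c
... | true = refl
... | false = refl

noDoubleCover-tail : ∀ {n} (E : List (Edge n)) c cs → noDoubleCover E (c ∷ cs) ≡ true → noDoubleCover E cs ≡ true
noDoubleCover-tail E c cs h = ∧-elimʳ h

noDoubleCover-head : ∀ {n} (E : List (Edge n)) c cs → noDoubleCover E (c ∷ cs) ≡ true → coverCount c E ≤ 1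
noDoubleCover-head E c cs h = ≤ᵇ≡true⇒≤ (∧-elimˡ h)

noDoubleCover-filterᵇ : ∀ {n} (E : List (Edge n)) q cs → noDoubleCover E cs ≡ true → noDoubleCover (filterᵇ q E) cs ≡ true
noDoubleCover-filterᵇ E q [] h = refl
noDoubleCover-filterᵇ E q (c ∷ cs) h = ∧-intro (≤⇒≤ᵇ≡true (≤-trans (countᵇ-filterᵇ-≤ (λ e → covers e c) q E) (≤ᵇ≡true⇒≤ (∧-elimˡ h)))) (noDoubleCover-filterᵇ E q cs (∧-elimʳ h))

uncoveredBy : ∀ {n} → Clause n → List (Edge n) → List (Edge n)
uncoveredBy c E = filterᵇ (λ e → not (covers e c)) E

allCovered-uncoveredBy : ∀ {n} (E : List (Edge n)) c cs → allCovered E (c ∷ cs) ≡ true → allCovered (uncoveredBy c E) cs ≡ true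
allCovered-uncoveredBy [] c cs h = refl
allCovered-uncoveredBy (e ∷ E) c cs h = go (covers e c) refl
  where
  go : ∀ b → covers e c ≡ b → allCovered (filterᵇ (λ e → not (covers e c)) (e ∷ E)) cs ≡ true
  go true ce rewrite ce = allCovered-uncoveredBy E c cs h
  go false ce rewrite ce = ∧-intro (∧-elimˡ h) (allCovered-uncoveredBy E c cs (∧-elimʳ h))

length-uncoveredBy : ∀ {n} c (E : List (Edge n)) → length (uncoveredBy c E) + coverCount c E ≡ length E
length-uncoveredBy c [] = refl
length-uncoveredBy c (e ∷ E) with covers e c
... | true = trans (+-suc _ _) (cong suc (length-uncoveredBy c E))
... | false = cong suc (length-uncoveredBy c E)

uncoveredBy-none : ∀ {n} c (E : List (Edge n)) → coverCount c E ≡ 0 → uncoveredBy c E ≡ E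
uncoveredBy-none c [] h = refl
uncoveredBy-none c (e ∷ E) h with covers e c
... | false = cong (e ∷_) (uncoveredBy-none c E h)

posPMMCount-∷-≤ : ∀ {n m} (x : Fin n) (c : Clause n) (v : Formula n m) → posPMMCount v x ≤ posPMMCount (c ∷ v) x
posPMMCount-∷-≤ x c v rewrite posPMMCount-∷ x c v = m≤n+m _ _

posPMMCount-∷-true : ∀ {n m} (x : Fin n) (c : Clause n) (v : Formula n m) → posPMM x c ≡ true → posPMMCount (c ∷ v) x ≡ suc (posPMMCount v x)
posPMMCount-∷-true x c v px rewrite posPMMCount-∷ x c v | px = refl

record IsPathEvent {n m} (x y : Fin n) (a b : ℕ) (E : List (Edge n)) (v : Formula n m) : Set where
  constructor isPathEvent
  field
    isolatedˣ : posPMMCount v x ≤ a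
    isolatedʸ : posPMMCount v y ≤ b
    covered : allCovered E (toList v) ≡ true
    noDouble : noDoubleCover E (toList v) ≡ true

toIsPathEvent : ∀ {n m} (x y : Fin n) a b E (v : Formula n m) → PathEvent x y a b E v ≡ true → IsPathEvent x y a b E v
toIsPathEvent x y a b E v h =
  let A = posPMMCount v x ≤ᵇ a ; B = posPMMCount v y ≤ᵇ b ; C = allCovered E (toList v) ; D = noDoubleCover E (toList v)
      h1 = ∧-elimˡ {A} {B ∧ (C ∧ D)} h ; h2 = ∧-elimʳ {A} {B ∧ (C ∧ D)} h
      h3 = ∧-elimˡ {B} {C ∧ D} h2 ; h4 = ∧-elimʳ {B} {C ∧ D} h2
  in isPathEvent (≤ᵇ≡true⇒≤ h1) (≤ᵇ≡true⇒≤ h3) (∧-elimˡ {C} {D} h4) (∧-elimʳ {C} {D} h4)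

fromIsPathEvent : ∀ {n m} (x y : Fin n) a b E (v : Formula n m) → IsPathEvent x y a b E v → PathEvent x y a b E v ≡ true
fromIsPathEvent x y a b E v (isPathEvent p q r s) = ∧-intro (≤⇒≤ᵇ≡true p) (∧-intro (≤⇒≤ᵇ≡true q) (∧-intro r s))

pathEvent-covered : ∀ {n m} (x y : Fin n) a b E (c : Clause n) (v : Formula n m) →
  PathEvent x y a b E (c ∷ v) ≡ true → PathEvent x y a b (uncoveredBy c E) v ≡ true
pathEvent-covered x y a b E c v h with toIsPathEvent x y a b E (c ∷ v) h
... | isPathEvent p q r s = fromIsPathEvent x y a b _ v (isPathEvent (≤-trans (posPMMCount-∷-≤ x c v) p) (≤-trans (posPMMCount-∷-≤ y c v) q)
        (allCovered-uncoveredBy E c (toList v) r) (noDoubleCover-filterᵇ E _ (toList v) (noDoubleCover-tail E c (toList v) s)))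

pathEvent-uncovered : ∀ {n m} (x y : Fin n) a b a' b' E (c : Clause n) (v : Formula n m) → coverCount c E ≡ 0 →
  (posPMMCount (c ∷ v) x ≤ a → posPMMCount v x ≤ a') →
  (posPMMCount (c ∷ v) y ≤ b → posPMMCount v y ≤ b') →
  PathEvent x y a b E (c ∷ v) ≡ true → PathEvent x y a' b' E v ≡ true
pathEvent-uncovered x y a b a' b' E c v h0 ha hb h with toIsPathEvent x y a b E (c ∷ v) h
... | isPathEvent p q r s = fromIsPathEvent x y a' b' E v (isPathEvent (ha p) (hb q)
        (subst (λ F → allCovered F (toList v) ≡ true) (uncoveredBy-none c E h0) (allCovered-uncoveredBy E c (toList v) r))
        (noDoubleCover-tail E c (toList v) s))

pathEvent-doublyCovered : ∀ {n m} (x y : Fin n) a b E (c : Clause n) (v : Formula n m) → 2 ≤ coverCount c E →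
  PathEvent x y a b E (c ∷ v) ≡ false
pathEvent-doublyCovered x y a b E c v h2 with PathEvent x y a b E (c ∷ v) in e
... | false = refl
... | true = ⊥-elim (<⇒≱ h2 (noDoubleCover-head E c (toList v) (IsPathEvent.noDouble (toIsPathEvent x y a b E (c ∷ v) e))))


pathsOfLength0 : ∀ {n} → Bool → List (List (Edge n))
pathsOfLength0 true = [] ∷ []
pathsOfLength0 false = []

paths : ∀ {n} → Fin n → Fin n → ℕ → List (List (Edge n))
paths x u zero = pathsOfLength0 (u == x)
paths {n} x u (suc k) = concatMap (λ z → map ((z , u) ∷_) (paths x z k)) (allFinL n)

length-∈-paths : ∀ {n} (x u : Fin n) k E → E ∈ paths x u k → length E ≡ k
length-∈-paths x u zero E m = go (u == x) m
  where
  go : ∀ b → E ∈ pathsOfLength0 b → length E ≡ 0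
  go true (here refl) = refl
length-∈-paths {n} x u (suc k) E m = go (allFinL n) m
  where
  go : ∀ zs → E ∈ concatMap (λ z → map ((z , u) ∷_) (paths x z k)) zs → length E ≡ suc k
  go (z ∷ zs) m with ∈-++⁻ (map ((z , u) ∷_) (paths x z k)) m
  ... | inj₁ m1 with ∈-map⁻ ((z , u) ∷_) m1
  ... | E' , m2 , refl = cong suc (length-∈-paths x z k E' m2)
  go (z ∷ zs) m | inj₂ m1 = go zs m1

length-pathsOfLength0 : ∀ {n} b → length (pathsOfLength0 {n} b) ≡ 𝟙 b
length-pathsOfLength0 true = refl
length-pathsOfLength0 false = refl

sum-length-paths : ∀ {n} (x : Fin n) k → sumFin n (λ u → length (paths x u k)) ≡ n ^ k
sum-length-paths {n} x zero = trans (sumFin-cong n _ _ (λ u → length-pathsOfLength0 (u == x))) (sumFin-𝟙-== n x)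
sum-length-paths {n} x (suc k) = trans (sumFin-cong n _ _ (λ u → trans (length-concatMap _ (allFinL n))
     (trans (sum-mono-eq u) (trans (sum-map-allFin n _) (sum-length-paths x k))))) (sumFin-const n (n ^ k))
  where
  sum-mono-eq : ∀ u → sum (map (λ z → length (map ((z , u) ∷_) (paths x z k))) (allFinL n)) ≡ sum (map (λ z → length (paths x z k)) (allFinL n))
  sum-mono-eq u = cong sum (map-cong (λ z → length-map ((z , u) ∷_) (paths x z k)) (allFinL n))


module ShortestPath {n m} (φ : Formula n m) (x : Fin n) where
  cs = toList φ
  within : ℕ → Fin n → Bool
  within k u = withinDist φ k x u

  within-suc : ∀ k u → within k u ≡ true → within (suc k) u ≡ true
  within-suc k u h = ∨-introˡ _ h

  within-adj : ∀ k z u → within k z ≡ true → adj φ z u ≡ true → within (suc k) u ≡ true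
  within-adj k z u h1 h2 = ∨-introʳ (within k u) (any-∈ (λ z' → within k z' ∧ adj φ z' u) (∈-allFin z) (∧-intro h1 h2))

  within-suc-split : ∀ k u → within (suc k) u ≡ true → within k u ≡ false → ∃ λ z → within k z ≡ true × adj φ z u ≡ true
  within-suc-split k u h hf with any-witness (λ z' → within k z' ∧ adj φ z' u) (allFinL n) (subst (λ b → b ∨ any (λ z' → within k z' ∧ adj φ z' u) (allFinL n) ≡ true) hf h)
  ... | z , _ , pz = z , ∧-elimˡ {within k z} {adj φ z u} pz , ∧-elimʳ {within k z} {adj φ z u} pz

  startsWithin : ℕ → List (Edge n) → Bool
  startsWithin j [] = true
  startsWithin j (e ∷ E) = within j (proj₁ e) ∧ startsWithin j E

  layered : ℕ → List (Edge n) → Bool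
  layered zero [] = true
  layered zero (_ ∷ _) = false
  layered (suc j) E = startsWithin j E

  GoodPath : ℕ → List (Edge n) → Bool
  GoodPath k E = allCovered E cs ∧ (noDoubleCover E cs ∧ layered k E)

  goodPath-allCovered : ∀ k E → GoodPath k E ≡ true → allCovered E cs ≡ true
  goodPath-allCovered k E = ∧-elimˡ

  goodPath-noDoubleCover : ∀ k E → GoodPath k E ≡ true → noDoubleCover E cs ≡ true
  goodPath-noDoubleCover k E g = ∧-elimˡ (∧-elimʳ {allCovered E cs} g)

  startsWithin-suc : ∀ j E → startsWithin j E ≡ true → startsWithin (suc j) E ≡ true
  startsWithin-suc j [] h = refl
  startsWithin-suc j (e ∷ E) h = ∧-intro (within-suc j (proj₁ e) (∧-elimˡ h)) (startsWithin-suc j E (∧-elimʳ h))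

  noDoubleCover-intro : ∀ (E : List (Edge n)) cs' → (∀ c → c ∈ cs' → coverCount c E ≤ 1) → noDoubleCover E cs' ≡ true
  noDoubleCover-intro E [] h = refl
  noDoubleCover-intro E (c ∷ cs') h = ∧-intro (≤⇒≤ᵇ≡true (h c (here refl))) (noDoubleCover-intro E cs' (λ c' m → h c' (there m)))

  noDoubleCover-elim : ∀ (E : List (Edge n)) cs' c → noDoubleCover E cs' ≡ true → c ∈ cs' → coverCount c E ≤ 1
  noDoubleCover-elim E (c ∷ cs') .c h (here refl) = ≤ᵇ≡true⇒≤ (∧-elimˡ h)
  noDoubleCover-elim E (c' ∷ cs') c h (there mm) = noDoubleCover-elim E cs' c (∧-elimʳ h) mm

  coverCount-≡0 : ∀ j c E → startsWithin j E ≡ true → (∀ a → within j a ≡ true → occIn a c ≡ true → ⊥) → coverCount c E ≡ 0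
  coverCount-≡0 j c [] h H = refl
  coverCount-≡0 j c (e ∷ E) h H = go (covers e c) refl
    where
    go : ∀ b → covers e c ≡ b → coverCount c (e ∷ E) ≡ 0
    go true eb = ⊥-elim (H (proj₁ e) (∧-elimˡ h) (∧-elimˡ (∧-elimʳ {not (proj₁ e == proj₂ e)} eb)))
    go false eb rewrite eb = coverCount-≡0 j c E (∧-elimʳ h) H

  occIn⇒adj : ∀ c a u → c ∈ cs → occIn a c ≡ true → occIn u c ≡ true → (a == u) ≡ false → adj φ a u ≡ true
  occIn⇒adj c a u mm h1 h2 h3 rewrite h3 = any-∈ (λ c' → occIn a c' ∧ occIn u c') mm (∧-intro h1 h2)

  layered-∷ : ∀ k z u E → within k z ≡ true → layered k E ≡ true → layered (suc k) ((z , u) ∷ E) ≡ true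
  layered-∷ zero z u [] wz _ = ∧-intro wz refl
  layered-∷ (suc j) z u E wz afE = ∧-intro wz (startsWithin-suc j E afE)

  coverCount-beyond≡0 : ∀ k c E u → within k u ≡ false → layered k E ≡ true → c ∈ cs → occIn u c ≡ true → coverCount c E ≡ 0
  coverCount-beyond≡0 zero c [] u wu afE mm occu = refl
  coverCount-beyond≡0 (suc j) c E u wu afE mm occu = coverCount-≡0 j c E afE H
    where
    H : ∀ a → within j a ≡ true → occIn a c ≡ true → ⊥
    H a wa oa = byEquality (a == u) refl
      where
      byEquality : ∀ b → (a == u) ≡ b → ⊥
      byEquality true e rewrite ==⇒≡ e = false≢true (trans (sym wu) (within-suc j u wa))
      byEquality false e = false≢true (trans (sym wu) (within-adj j a u wa (occIn⇒adj c a u mm oa occu e)))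

  -- Earlier edges start within distance k - 1 of x and u is not within distance k, so a clause
  -- containing u covers no earlier edge (coverCount-beyond≡0).
  goodPath-∷ : ∀ k z u E → within k z ≡ true → within k u ≡ false → adj φ z u ≡ true → GoodPath k E ≡ true → GoodPath (suc k) ((z , u) ∷ E) ≡ true
  goodPath-∷ k z u E wz wu azu g = ∧-intro (∧-intro covzu g1) (∧-intro noDouble (layered-∷ k z u E wz g3))
    where
    g1 = ∧-elimˡ {allCovered E cs} {noDoubleCover E cs ∧ layered k E} g
    g23 = ∧-elimʳ {allCovered E cs} {noDoubleCover E cs ∧ layered k E} g
    g2 = ∧-elimˡ {noDoubleCover E cs} {layered k E} g23
    g3 = ∧-elimʳ {noDoubleCover E cs} {layered k E} g23
    covzu : any (covers (z , u)) cs ≡ true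
    covzu with any-witness (λ c → occIn z c ∧ occIn u c) cs (∧-elimʳ {not (z == u)} azu)
    ... | c , mm , pc = any-∈ (covers (z , u)) mm (∧-intro (∧-elimˡ {not (z == u)} azu) pc)
    noDouble : noDoubleCover ((z , u) ∷ E) cs ≡ true
    noDouble = noDoubleCover-intro _ cs λ c mm → pc c mm (covers (z , u) c) refl
      where
      pc : ∀ c → c ∈ cs → ∀ b → covers (z , u) c ≡ b → coverCount c ((z , u) ∷ E) ≤ 1
      pc c mm false eb rewrite eb = noDoubleCover-elim E cs c g2 mm
      pc c mm true eb rewrite eb = subst (λ t → suc t ≤ 1) (sym (coverCount-beyond≡0 k c E u wu g3 mm occu)) (s≤s z≤n)
        where
        occu : occIn u c ≡ true
        occu = ∧-elimʳ {occIn z c} (∧-elimʳ {not (z == u)} eb)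

  goodPath-exists : ∀ k u → within k u ≡ true → (∀ k' → k ≡ suc k' → within k' u ≡ false) → any (GoodPath k) (paths x u k) ≡ true
  goodPath-exists zero u w _ rewrite ==-sym x u w = ∨-introˡ false (∧-intro refl (∧-intro (noDoubleCover-intro [] cs (λ _ _ → z≤n)) refl))
  goodPath-exists (suc k) u w exactᵘ with within-suc-split k u w (exactᵘ k refl)
  ... | z , wz , azu = any-concatMap⁺ (GoodPath (suc k)) (λ z' → map ((z' , u) ∷_) (paths x z' k)) (allFinL n) z (∈-allFin z)
        (any-map⁺ (GoodPath k) (GoodPath (suc k)) ((z , u) ∷_) (paths x z k) (λ E g → goodPath-∷ k z u E wz (exactᵘ k refl) azu g)
          (goodPath-exists k z wz exactᶻ))
    where
    exactᶻ : ∀ k'' → k ≡ suc k'' → within k'' z ≡ false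
    exactᶻ k'' e = byEquality (within k'' z) refl
      where
      byEquality : ∀ b → within k'' z ≡ b → within k'' z ≡ false
      byEquality false eb = eb
      byEquality true eb = ⊥-elim (false≢true (trans (sym (exactᵘ k refl)) (subst (λ j → within j u ≡ true) (sym e) (within-adj k'' z u eb azu))))

  exactDistance : ∀ d u → within d u ≡ true → ∃ λ k → k ≤ d × within k u ≡ true × (∀ k' → k ≡ suc k' → within k' u ≡ false)
  exactDistance zero u w = zero , z≤n , w , (λ k' ())
  exactDistance (suc d) u w = go (within d u) refl
    where
    go : ∀ b → within d u ≡ b → ∃ λ k → k ≤ suc d × within k u ≡ true × (∀ k' → k ≡ suc k' → within k' u ≡ false)
    go true e with exactDistance d u e
    ... | k , kd , wk , exact = k , m≤n⇒m≤1+n kd , wk , exact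
    go false e = suc d , ≤-refl , w , (λ { k' refl → e })

  pathCertificate : ∀ d y → within d y ≡ true → (x == y) ≡ false → ∃ λ k → 1 ≤ k × k ≤ d × any (GoodPath k) (paths x y k) ≡ true
  pathCertificate d y w hxy with exactDistance d y w
  ... | zero , kd , wk , _ = ⊥-elim (false≢true (trans (sym hxy) wk))
  ... | suc k , kd , wk , exact = suc k , s≤s z≤n , kd , goodPath-exists (suc k) y wk exact


-- Counting formulas that carry a certificate

module Weight (α R β : ℕ) where
  weight : ℕ → ℕ → ℕ → ℕ → ℕ
  weight m a b s = suc m ^ s * α ^ s * R ^ m * (R + m * β) ^ (a + b)

  weightˣ : ℕ → ℕ → ℕ → ℕ → ℕ
  weightˣ m zero    b s = 0
  weightˣ m (suc a) b s = R * weight m a b s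

  weightʸ : ℕ → ℕ → ℕ → ℕ → ℕ
  weightʸ m a zero    s = 0
  weightʸ m a (suc b) s = R * weight m a b s

  isolatedWeight : ℕ → ℕ → ℕ → ℕ
  isolatedWeight m s k = suc m ^ s * (α ^ s * R ^ suc m) * (β * (R + m * β) ^ k)

  weight-edge : ∀ m a b s → s * α * (R * weight m a b (s ∸ 1)) ≡ s * (1 * suc m ^ (s ∸ 1)) * (α ^ s * R ^ suc m) * (R + m * β) ^ (a + b)
  weight-edge m a b zero = refl
  weight-edge m a b (suc s) = reorder (suc s) α R (suc m ^ s) (α ^ s) (R ^ m) ((R + m * β) ^ (a + b))
    where
    reorder : ∀ s α R A B C V → s * α * (R * (A * B * C * V)) ≡ s * (1 * A) * (α * B * (R * C)) * V
    reorder = solve-∀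

  β*R*weight : ∀ m a b s → β * (R * weight m a b s) ≡ isolatedWeight m s (a + b)
  β*R*weight m a b s = reorder β R (suc m ^ s) (α ^ s) (R ^ m) ((R + m * β) ^ (a + b))
    where
    reorder : ∀ β R U A C F → β * (R * (U * A * C * F)) ≡ U * (A * (R * C)) * (β * F)
    reorder = solve-∀

  weight-isolated : ∀ m s a b → β * weightˣ m a b s + β * weightʸ m a b s ≤ (a + b) * isolatedWeight m s (a + b ∸ 1)
  weight-isolated m s zero zero = ≤-reflexive (cong₂ _+_ (*-zeroʳ β) (*-zeroʳ β))
  weight-isolated m s (suc a) zero = begin
    β * (R * weight m a 0 s) + β * 0 ≡⟨ cong₂ _+_ (β*R*weight m a 0 s) (*-zeroʳ β) ⟩
    isolatedWeight m s (a + 0) + 0   ≡⟨ +-identityʳ _ ⟩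
    isolatedWeight m s (a + 0)       ≤⟨ m≤n*m _ (suc a + 0) ⟩
    (suc a + 0) * isolatedWeight m s (a + 0) ∎
    where open ≤-Reasoning
  weight-isolated m s zero (suc b) = begin
    β * 0 + β * (R * weight m 0 b s) ≡⟨ cong₂ _+_ (*-zeroʳ β) (β*R*weight m 0 b s) ⟩
    isolatedWeight m s b             ≤⟨ m≤n*m _ (suc b) ⟩
    suc b * isolatedWeight m s b     ∎
    where open ≤-Reasoning
  weight-isolated m s (suc a) (suc b) = begin
    β * (R * weight m a (suc b) s) + β * (R * weight m (suc a) b s)
      ≡⟨ cong₂ _+_ (β*R*weight m a (suc b) s) (trans (β*R*weight m (suc a) b s) (cong (isolatedWeight m s) (sym (+-suc a b)))) ⟩
    X + X       ≡⟨ cong (X +_) (sym (+-identityʳ X)) ⟩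
    2 * X       ≤⟨ *-monoˡ-≤ X (s≤s (subst (1 ≤_) (sym (+-suc a b)) (s≤s z≤n))) ⟩
    (suc a + suc b) * X ∎
    where
    open ≤-Reasoning
    X = isolatedWeight m s (a + suc b)

  weight-step : ∀ m a b s → s * α * (R * weight m a b (s ∸ 1)) + β * weightˣ m a b s + β * weightʸ m a b s + R * weight m a b s ≤ weight (suc m) a b s
  weight-step m a b s = begin
    s * α * (R * weight m a b (s ∸ 1)) + β * weightˣ m a b s + β * weightʸ m a b s + R * weight m a b s
      ≡⟨ cong₂ (λ p q → p + β * weightˣ m a b s + β * weightʸ m a b s + q) (weight-edge m a b s) (reorder R U (α ^ s) (R ^ m) V) ⟩
    U₁ * Z * V + β * weightˣ m a b s + β * weightʸ m a b s + U * Z * V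
      ≡⟨ cong (_+ U * Z * V) (+-assoc (U₁ * Z * V) _ _) ⟩
    U₁ * Z * V + (β * weightˣ m a b s + β * weightʸ m a b s) + U * Z * V
      ≤⟨ +-monoˡ-≤ (U * Z * V) (+-monoʳ-≤ (U₁ * Z * V) (weight-isolated m s a b)) ⟩
    U₁ * Z * V + (a + b) * (U * Z * V₁) + U * Z * V
      ≤⟨ m≤m+n _ (U₁ * Z * ((a + b) * V₁)) ⟩
    U₁ * Z * V + (a + b) * (U * Z * V₁) + U * Z * V + U₁ * Z * ((a + b) * V₁)
      ≡⟨ factor U U₁ Z V V₁ (a + b) ⟩
    (U + U₁) * Z * (V + (a + b) * V₁)
      ≤⟨ *-mono-≤ (*-monoˡ-≤ Z (subst (λ z → U + U₁ ≤ z ^ s) (+-comm (suc m) 1) (bernoulli s (suc m) 1))) (bernoulli (a + b) Q β) ⟩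
    suc (suc m) ^ s * Z * (Q + β) ^ (a + b)
      ≡⟨ cong (λ z → suc (suc m) ^ s * Z * z ^ (a + b)) (+-assoc R (m * β) β) ⟩
    suc (suc m) ^ s * Z * (R + (m * β + β)) ^ (a + b)
      ≡⟨ cong (λ z → suc (suc m) ^ s * Z * (R + z) ^ (a + b)) (+-comm (m * β) β) ⟩
    suc (suc m) ^ s * Z * (R + suc m * β) ^ (a + b)
      ≡⟨ cong (_* (R + suc m * β) ^ (a + b)) (sym (*-assoc (suc (suc m) ^ s) (α ^ s) (R * R ^ m))) ⟩
    weight (suc m) a b s ∎
    where
    open ≤-Reasoning
    Q = R + m * β
    U = suc m ^ s
    U₁ = s * (1 * suc m ^ (s ∸ 1))
    Z = α ^ s * R ^ suc m
    V = Q ^ (a + b)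
    V₁ = β * Q ^ (a + b ∸ 1)
    reorder : ∀ R U A C V → R * (U * A * C * V) ≡ U * (A * (R * C)) * V
    reorder = solve-∀
    factor : ∀ U U₁ Z V V₁ k → U₁ * Z * V + k * (U * Z * V₁) + U * Z * V + U₁ * Z * (k * V₁) ≡ (U + U₁) * Z * (V + k * V₁)
    factor = solve-∀


module IsolatedPaths (n : ℕ) (x y : Fin n) (α β : ℕ)
  (covers≤α : ∀ e → countᵇ (covers e) (allClauses n) ≤ α)
  (posPMMˣ≤β : countᵇ (posPMM x) (allClauses n) ≤ β)
  (posPMMʸ≤β : countᵇ (posPMM y) (allClauses n) ≤ β) where

  L : List (Clause n)
  L = allClauses n

  R : ℕ
  R = countᵇ (neitherPMM x y) L

  open Weight α R β

  sum-coverCount : ∀ (E : List (Edge n)) → sum (map (λ c → coverCount c E) L) ≡ sum (map (λ e → countᵇ (covers e) L) E)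
  sum-coverCount [] = trans (sum-map-const 0 L) (*-zeroʳ (length L))
  sum-coverCount (e ∷ E) = trans (sum-map-+ (λ c → 𝟙 (covers e c)) (λ c → coverCount c E) L) (cong (countᵇ (covers e) L +_) (sum-coverCount E))

  countᵇ-covering≤ : ∀ (E : List (Edge n)) → countᵇ (λ c → 1 ≤ᵇ coverCount c E) L ≤ length E * α
  countᵇ-covering≤ E = begin
    countᵇ (λ c → 1 ≤ᵇ coverCount c E) L ≤⟨ sum-map-mono _ _ L (λ c → 𝟙-≤ (coverCount c E)) ⟩
    sum (map (λ c → coverCount c E) L)    ≡⟨ sum-coverCount E ⟩
    sum (map (λ e → countᵇ (covers e) L) E) ≤⟨ sum-map-mono _ _ E covers≤α ⟩
    sum (map (λ _ → α) E)                 ≡⟨ sum-map-const α E ⟩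
    length E * α                          ∎
    where open ≤-Reasoning

  Bound : ℕ → Set
  Bound m = ∀ a b (E : List (Edge n)) → countF n m (PathEvent x y a b E) * R ^ (a + b + length E) ≤ weight m a b (length E)

  countF-∷ : ℕ → ℕ → ℕ → List (Edge n) → Clause n → ℕ
  countF-∷ m a b E c = countF n m (λ v → PathEvent x y a b E (c ∷ v))

  stepWeight : ℕ → ℕ → ℕ → List (Edge n) → Clause n → ℕ
  stepWeight m a b E c = 𝟙 (1 ≤ᵇ coverCount c E) * (R * weight m a b (length E ∸ 1)) + 𝟙 (posPMM x c) * weightˣ m a b (length E)
    + 𝟙 (posPMM y c) * weightʸ m a b (length E) + 𝟙 (neitherPMM x y c) * weight m a b (length E)

  ≤R* : ∀ {F F' K} X → F ≤ F' → F' * K ≤ X → F * (R * K) ≤ R * X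
  ≤R* {F} {F'} {K} X F≤F' F'K≤X = begin
    F * (R * K) ≡⟨ x∙yz≈y∙xz F R K ⟩
    R * (F * K) ≤⟨ *-monoʳ-≤ R (≤-trans (*-monoˡ-≤ K F≤F') F'K≤X) ⟩
    R * X       ∎
    where open ≤-Reasoning

  countF-∷-posPMMˣ : ∀ {m} → Bound m → ∀ a b E c → posPMM x c ≡ true → coverCount c E ≡ 0 →
    countF-∷ m a b E c * R ^ (a + b + length E) ≤ weightˣ m a b (length E)
  countF-∷-posPMMˣ {m} ih zero b E c px _ = ≤-reflexive (cong (_* _) (countF-never n m _ λ v h →
    n≮0 (subst (_≤ 0) (posPMMCount-∷-true x c v px) (IsPathEvent.isolatedˣ (toIsPathEvent x y 0 b E (c ∷ v) h)))))
  countF-∷-posPMMˣ {m} ih (suc a) b E c px none = ≤R* _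
    (countF-mono n m _ _ λ v → pathEvent-uncovered x y (suc a) b a b E c v none
      (λ h → s≤s⁻¹ (subst (_≤ suc a) (posPMMCount-∷-true x c v px) h)) (≤-trans (posPMMCount-∷-≤ y c v)))
    (ih a b E)

  countF-∷-posPMMʸ : ∀ {m} → Bound m → ∀ a b E c → posPMM y c ≡ true → coverCount c E ≡ 0 →
    countF-∷ m a b E c * R ^ (a + b + length E) ≤ weightʸ m a b (length E)
  countF-∷-posPMMʸ {m} ih a zero E c py _ = ≤-reflexive (cong (_* _) (countF-never n m _ λ v h →
    n≮0 (subst (_≤ 0) (posPMMCount-∷-true y c v py) (IsPathEvent.isolatedʸ (toIsPathEvent x y a 0 E (c ∷ v) h)))))
  countF-∷-posPMMʸ {m} ih a (suc b) E c py none =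
    subst (λ k → countF-∷ m a (suc b) E c * R ^ (k + length E) ≤ R * weight m a b (length E)) (sym (+-suc a b))
      (≤R* _ (countF-mono n m _ _ λ v → pathEvent-uncovered x y a (suc b) a b E c v none
          (≤-trans (posPMMCount-∷-≤ x c v)) (λ h → s≤s⁻¹ (subst (_≤ suc b) (posPMMCount-∷-true y c v py) h)))
        (ih a b E))

  countF-∷-neither : ∀ {m} → Bound m → ∀ a b E c → coverCount c E ≡ 0 →
    countF-∷ m a b E c * R ^ (a + b + length E) ≤ weight m a b (length E)
  countF-∷-neither {m} ih a b E c none = ≤-trans
    (*-monoˡ-≤ _ (countF-mono n m _ _ λ v →
      pathEvent-uncovered x y a b a b E c v none (≤-trans (posPMMCount-∷-≤ x c v)) (≤-trans (posPMMCount-∷-≤ y c v))))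
    (ih a b E)

  countF-∷-covered : ∀ {m} → Bound m → ∀ a b E c → coverCount c E ≡ 1 →
    countF-∷ m a b E c * R ^ (a + b + length E) ≤ R * weight m a b (length E ∸ 1)
  countF-∷-covered {m} ih a b E c once =
    subst (λ k → countF-∷ m a b E c * R ^ (a + b + k) ≤ R * weight m a b (k ∸ 1)) (sym length≡)
      (subst (λ t → countF-∷ m a b E c * t ≤ R * weight m a b ℓ) (sym (cong (R ^_) (+-suc (a + b) ℓ)))
        (≤R* _ (countF-mono n m _ _ λ v → pathEvent-covered x y a b E c v) (ih a b (uncoveredBy c E))))
    where
    ℓ = length (uncoveredBy c E)
    length≡ : length E ≡ suc ℓ
    length≡ = trans (sym (length-uncoveredBy c E)) (trans (cong (ℓ +_) once) (+-comm ℓ 1))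

  countF-∷-uncovered : ∀ {m} → Bound m → ∀ a b E c → coverCount c E ≡ 0 →
    countF-∷ m a b E c * R ^ (a + b + length E) ≤ stepWeight m a b E c
  countF-∷-uncovered {m} ih a b E c none = bySign (posPMM x c) (posPMM y c) refl refl
    where
    bySign : ∀ bˣ bʸ → posPMM x c ≡ bˣ → posPMM y c ≡ bʸ →
      countF-∷ m a b E c * R ^ (a + b + length E) ≤ stepWeight m a b E c
    bySign true  _     px _  = ≤-trans (countF-∷-posPMMˣ ih a b E c px none) (≤-summand₂ (1 ≤ᵇ coverCount c E) (posPMM x c) (posPMM y c) (neitherPMM x y c) _ _ _ _ px)
    bySign false true  _  py = ≤-trans (countF-∷-posPMMʸ ih a b E c py none) (≤-summand₃ (1 ≤ᵇ coverCount c E) (posPMM x c) (posPMM y c) (neitherPMM x y c) _ _ _ _ py)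
    bySign false false px py = ≤-trans (countF-∷-neither ih a b E c none)
      (≤-summand₄ (1 ≤ᵇ coverCount c E) (posPMM x c) (posPMM y c) (neitherPMM x y c) _ _ _ _ (cong₂ (λ p q → not p ∧ not q) px py))

  countF-∷-bound : ∀ {m} → Bound m → ∀ a b E c →
    countF-∷ m a b E c * R ^ (a + b + length E) ≤ stepWeight m a b E c
  countF-∷-bound {m} ih a b E c = byCoverCount (coverCount c E) refl
    where
    byCoverCount : ∀ k → coverCount c E ≡ k → countF-∷ m a b E c * R ^ (a + b + length E) ≤ stepWeight m a b E c
    byCoverCount zero          cc = countF-∷-uncovered ih a b E c cc
    byCoverCount (suc zero)    cc = ≤-trans (countF-∷-covered ih a b E c cc) (≤-summand₁ (1 ≤ᵇ coverCount c E) (posPMM x c) (posPMM y c) (neitherPMM x y c) _ _ _ _ (cong (1 ≤ᵇ_) cc))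
    byCoverCount (suc (suc _)) cc = ≤-trans (≤-reflexive (cong (_* _) (countF-false n m _ λ v →
      pathEvent-doublyCovered x y a b E c v (≤-trans (s≤s (s≤s z≤n)) (≤-reflexive (sym cc)))))) z≤n

  sum-stepWeight : ∀ m a b E → sum (map (stepWeight m a b E) L) ≤ weight (suc m) a b (length E)
  sum-stepWeight m a b E = begin
    sum (map (stepWeight m a b E) L)
      ≡⟨ sum-map-𝟙-*₄ (λ c → 1 ≤ᵇ coverCount c E) (posPMM x) (posPMM y) (neitherPMM x y) _ _ _ _ L ⟩
    countᵇ (λ c → 1 ≤ᵇ coverCount c E) L * X + countᵇ (posPMM x) L * weightˣ m a b s
      + countᵇ (posPMM y) L * weightʸ m a b s + R * weight m a b s
      ≤⟨ +-monoˡ-≤ _ (+-mono-≤ (+-mono-≤ (*-monoˡ-≤ X (countᵇ-covering≤ E)) (*-monoˡ-≤ _ posPMMˣ≤β)) (*-monoˡ-≤ _ posPMMʸ≤β)) ⟩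
    s * α * X + β * weightˣ m a b s + β * weightʸ m a b s + R * weight m a b s
      ≤⟨ weight-step m a b s ⟩
    weight (suc m) a b s ∎
    where
    open ≤-Reasoning
    s = length E
    X = R * weight m a b (s ∸ 1)

  -- Peel off the first clause c: it covers one remaining path edge (at most α choices per
  -- edge), or is a (+,-,-) clause with x or y positive (β choices, using up one unit of a or b),
  -- or is one of the R clauses of neither kind; two covered edges are excluded by PathEvent.
  countF-pathEvent : ∀ m → Bound m
  countF-pathEvent zero a b [] = countF-pathEvent-base a b
    where
    countF-pathEvent-base : ∀ a b → 1 * R ^ (a + b + 0) ≤ 1 * 1 * 1 * (R + 0 * β) ^ (a + b)
    countF-pathEvent-base a b rewrite +-identityʳ (a + b) | +-identityʳ R | *-identityˡ (R ^ (a + b)) = ≤-refl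
  countF-pathEvent zero a b (_ ∷ _) = z≤n
  countF-pathEvent (suc m) a b E = begin
    countF n (suc m) (PathEvent x y a b E) * K ≡⟨ sum-map-*ʳ (countF-∷ m a b E) K L ⟩
    sum (map (λ c → countF-∷ m a b E c * K) L) ≤⟨ sum-map-mono _ _ L (countF-∷-bound (countF-pathEvent m) a b E) ⟩
    sum (map (stepWeight m a b E) L)           ≤⟨ sum-stepWeight m a b E ⟩
    weight (suc m) a b (length E)              ∎
    where
    open ≤-Reasoning
    K = R ^ (a + b + length E)


weight⇒bound : ∀ (c n m R β α Y0 k d1 d2 : ℕ) → k ≤ d2 →
  c * R ^ (d1 + d1 + k) ≤ suc m ^ k * α ^ k * R ^ m * (R + m * β) ^ (d1 + d1) →
  suc m * α * n * n ≤ Y0 → n * (R + m * β) ≤ Y0 → n * R ≤ Y0 →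
  n ^ k * (c * (n * R) ^ (d1 + d1 + d2)) ≤ Y0 ^ (d1 + d1 + d2) * R ^ m
weight⇒bound c n m R β α Y0 k d1 d2 kd hc b1 b2 b3 with m≤n⇒∃[o]m+o≡n kd
... | e , refl = begin
  n ^ k * (c * (n * R) ^ (d1 + d1 + (k + e))) ≡⟨ cong (λ z → n ^ k * (c * (n * R) ^ z)) (sym (+-assoc (d1 + d1) k e)) ⟩
  n ^ k * (c * (n * R) ^ (d1 + d1 + k + e)) ≡⟨ cong (λ z → n ^ k * (c * z)) (^-distribˡ-+-* (n * R) (d1 + d1 + k) e) ⟩
  n ^ k * (c * ((n * R) ^ (d1 + d1 + k) * (n * R) ^ e)) ≡⟨ cong (λ z → n ^ k * (c * (z * (n * R) ^ e))) (^-distribʳ-* n R (d1 + d1 + k)) ⟩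
  n ^ k * (c * (n ^ (d1 + d1 + k) * R ^ (d1 + d1 + k) * (n * R) ^ e)) ≡⟨ identity₁ (n ^ k) c (n ^ (d1 + d1 + k)) (R ^ (d1 + d1 + k)) ((n * R) ^ e) ⟩
  (c * R ^ (d1 + d1 + k)) * (n ^ k * n ^ (d1 + d1 + k) * (n * R) ^ e) ≤⟨ *-monoˡ-≤ _ hc ⟩
  (M ^ k * α ^ k * R ^ m * Q ^ (d1 + d1)) * (n ^ k * n ^ (d1 + d1 + k) * (n * R) ^ e) ≡⟨ cong (λ z → (M ^ k * α ^ k * R ^ m * Q ^ (d1 + d1)) * (n ^ k * z * (n * R) ^ e)) (^-distribˡ-+-* n (d1 + d1) k) ⟩
  (M ^ k * α ^ k * R ^ m * Q ^ (d1 + d1)) * (n ^ k * (n ^ (d1 + d1) * n ^ k) * (n * R) ^ e) ≡⟨ identity₂ (M ^ k) (α ^ k) (R ^ m) (Q ^ (d1 + d1)) (n ^ k) (n ^ (d1 + d1)) ((n * R) ^ e) ⟩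
  ((M ^ k * α ^ k) * n ^ k * n ^ k) * (n ^ (d1 + d1) * Q ^ (d1 + d1)) * (n * R) ^ e * R ^ m
    ≡⟨ cong₂ (λ u v → u * v * (n * R) ^ e * R ^ m) (trans (cong (λ z → z * n ^ k * n ^ k) (sym (^-distribʳ-* M α k))) (trans (cong (_* n ^ k) (sym (^-distribʳ-* (M * α) n k))) (sym (^-distribʳ-* (M * α * n) n k)))) (sym (^-distribʳ-* n Q (d1 + d1))) ⟩
  (M * α * n * n) ^ k * (n * Q) ^ (d1 + d1) * (n * R) ^ e * R ^ m ≤⟨ *-monoˡ-≤ (R ^ m) (*-mono-≤ (*-mono-≤ (^-monoˡ-≤ k b1) (^-monoˡ-≤ (d1 + d1) b2)) (^-monoˡ-≤ e b3)) ⟩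
  Y0 ^ k * Y0 ^ (d1 + d1) * Y0 ^ e * R ^ m ≡⟨ cong (_* R ^ m) (trans (cong (_* Y0 ^ e) (trans (*-comm (Y0 ^ k) _) (sym (^-distribˡ-+-* Y0 (d1 + d1) k)))) (sym (^-distribˡ-+-* Y0 (d1 + d1 + k) e))) ⟩
  Y0 ^ (d1 + d1 + k + e) * R ^ m ≡⟨ cong (λ z → Y0 ^ z * R ^ m) (+-assoc (d1 + d1) k e) ⟩
  Y0 ^ (d1 + d1 + (k + e)) * R ^ m ∎
  where
  open ≤-Reasoning
  M = suc m
  Q = R + m * β
  identity₁ : ∀ a c b r t → a * (c * (b * r * t)) ≡ (c * r) * (a * b * t)
  identity₁ = solve-∀
  identity₂ : ∀ Mk ak Rm Qd nk nd t → (Mk * ak * Rm * Qd) * (nk * (nd * nk) * t) ≡ ((Mk * ak) * nk * nk) * (nd * Qd) * t * Rm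
  identity₂ = solve-∀


-- The density condition

multichoose : ℕ → ℕ → ℕ
multichoose s zero = 1
multichoose zero (suc j) = 0
multichoose (suc s) (suc j) = multichoose s (suc j) + multichoose (suc s) j

risingFactorial : ℕ → ℕ → ℕ
risingFactorial s zero = 1
risingFactorial s (suc j) = risingFactorial s j * (s + j)

risingFactorial-shift : ∀ s j → risingFactorial s (suc j) ≡ s * risingFactorial (suc s) j
risingFactorial-shift s zero = identity s
  where
  identity : ∀ s → 1 * (s + 0) ≡ s * 1
  identity = solve-∀
risingFactorial-shift s (suc j) rewrite risingFactorial-shift s j = identity s (risingFactorial (suc s) j) j
  where
  identity : ∀ s r j → s * r * (s + suc j) ≡ s * (r * (suc s + j))
  identity = solve-∀

risingFactorial-pascal : ∀ s j → risingFactorial (suc s) (suc j) ≡ risingFactorial s (suc j) + suc j * risingFactorial (suc s) j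
risingFactorial-pascal s j rewrite risingFactorial-shift s j = identity s j (risingFactorial (suc s) j)
  where
  identity : ∀ s j r → r * (suc s + j) ≡ s * r + suc j * r
  identity = solve-∀

risingFactorial-multichoose : ∀ s j → j ! * multichoose s j ≡ risingFactorial s j
risingFactorial-multichoose s zero = refl
risingFactorial-multichoose zero (suc j) rewrite risingFactorial-shift 0 j = *-zeroʳ (suc j !)
risingFactorial-multichoose (suc s) (suc j) = begin
  suc j ! * (multichoose s (suc j) + multichoose (suc s) j) ≡⟨ *-distribˡ-+ (suc j !) _ _ ⟩
  suc j ! * multichoose s (suc j) + suc j ! * multichoose (suc s) j ≡⟨ cong (suc j ! * multichoose s (suc j) +_) (*-assoc (suc j) (j !) (multichoose (suc s) j)) ⟩
  suc j ! * multichoose s (suc j) + suc j * (j ! * multichoose (suc s) j) ≡⟨ cong₂ (λ a b → a + suc j * b) (risingFactorial-multichoose s (suc j)) (risingFactorial-multichoose (suc s) j) ⟩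
  risingFactorial s (suc j) + suc j * risingFactorial (suc s) j ≡⟨ sym (risingFactorial-pascal s j) ⟩
  risingFactorial (suc s) (suc j) ∎
  where open ≡-Reasoning

^≤risingFactorial : ∀ s j → s ^ j ≤ risingFactorial s j
^≤risingFactorial s zero = ≤-refl
^≤risingFactorial s (suc j) = ≤-trans (≤-reflexive (*-comm s (s ^ j))) (*-mono-≤ (^≤risingFactorial s j) (m≤m+n s j))

-- S s J = A^J · Σ_{j ≤ J} C(s+j-1, j) (c/A)^j is a partial sum of (1 - c/A)^(-s).  It
-- dominates the partial sums of e^c at s = A (expScaled≤S), and (1 - c/A) · S (s+1) ≤ S s
-- (S-step), which together give e^c · (1 - c/A)^A ≤ 1.
module ExpSeries (c A : ℕ) where
  S : ℕ → ℕ → ℕ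
  S s zero = 1
  S s (suc J) = A * S s J + multichoose s (suc J) * c ^ suc J

  S-recurrence : ∀ s J → A * S (suc s) J + multichoose (suc s) J * c ^ suc J ≡ A * S s J + c * S (suc s) J
  S-recurrence s zero = identity A c
    where
    identity : ∀ A c → A * 1 + 1 * (c * 1) ≡ A * 1 + c * 1
    identity = solve-∀
  S-recurrence s (suc J) = begin
    A * (A * a + (p + q) * C) + (p + q) * (c * C) ≡⟨ identity₁ A a p q C c ⟩
    A * (A * a + q * C) + (A * (p * C) + (p + q) * (c * C)) ≡⟨ cong (λ z → A * z + (A * (p * C) + (p + q) * (c * C))) (S-recurrence s J) ⟩
    A * (A * b + c * a) + (A * (p * C) + (p + q) * (c * C)) ≡⟨ identity₂ A a b p q C c ⟩
    A * (A * b + p * C) + c * (A * a + (p + q) * C) ∎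
    where
    open ≡-Reasoning
    a = S (suc s) J
    b = S s J
    p = multichoose s (suc J)
    q = multichoose (suc s) J
    C = c ^ suc J
    identity₁ : ∀ A a p q C c → A * (A * a + (p + q) * C) + (p + q) * (c * C) ≡ A * (A * a + q * C) + (A * (p * C) + (p + q) * (c * C))
    identity₁ = solve-∀
    identity₂ : ∀ A a b p q C c → A * (A * b + c * a) + (A * (p * C) + (p + q) * (c * C)) ≡ A * (A * b + p * C) + c * (A * a + (p + q) * C)
    identity₂ = solve-∀

  S-step : ∀ e → e + c ≡ A → ∀ s J → e * S (suc s) J ≤ A * S s J
  S-step e eq s J = +-cancelʳ-≤ (c * S (suc s) J) _ _ (begin
    e * S (suc s) J + c * S (suc s) J ≡⟨ sym (*-distribʳ-+ (S (suc s) J) e c) ⟩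
    (e + c) * S (suc s) J ≡⟨ cong (_* S (suc s) J) eq ⟩
    A * S (suc s) J ≤⟨ m≤m+n _ _ ⟩
    A * S (suc s) J + multichoose (suc s) J * c ^ suc J ≡⟨ S-recurrence s J ⟩
    A * S s J + c * S (suc s) J ∎)
    where open ≤-Reasoning

  S-iterate : ∀ e → e + c ≡ A → ∀ s J → e ^ s * S s J ≤ A ^ s * S 0 J
  S-iterate e eq zero J = ≤-refl
  S-iterate e eq (suc s) J = begin
    e * e ^ s * S (suc s) J ≡⟨ identity e (e ^ s) (S (suc s) J) ⟩
    e ^ s * (e * S (suc s) J) ≤⟨ *-monoʳ-≤ (e ^ s) (S-step e eq s J) ⟩
    e ^ s * (A * S s J) ≡⟨ identity′ (e ^ s) A (S s J) ⟩
    A * (e ^ s * S s J) ≤⟨ *-monoʳ-≤ A (S-iterate e eq s J) ⟩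
    A * (A ^ s * S 0 J) ≡⟨ sym (*-assoc A _ _) ⟩
    A * A ^ s * S 0 J ∎
    where
    open ≤-Reasoning
    identity : ∀ x y z → x * y * z ≡ y * (x * z)
    identity = solve-∀
    identity′ : ∀ x y z → x * (y * z) ≡ y * (x * z)
    identity′ = solve-∀

  S-zero : ∀ J → S 0 J ≡ A ^ J
  S-zero zero = refl
  S-zero (suc J) rewrite S-zero J = +-identityʳ _

  expScaled≤S : ∀ J → expScaled c J * A ^ J ≤ J ! * S A J
  expScaled≤S zero = ≤-refl
  expScaled≤S (suc J) = begin
    (suc J * E + c ^ suc J) * (A * A ^ J) ≡⟨ identity₁ (suc J) E (c ^ suc J) A (A ^ J) ⟩
    suc J * A * (E * A ^ J) + c ^ suc J * A ^ suc J ≤⟨ +-mono-≤ (*-monoʳ-≤ (suc J * A) (expScaled≤S J)) (*-monoʳ-≤ (c ^ suc J) (^≤risingFactorial A (suc J))) ⟩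
    suc J * A * (J ! * S A J) + c ^ suc J * risingFactorial A (suc J) ≡⟨ cong (λ z → suc J * A * (J ! * S A J) + c ^ suc J * z) (sym (risingFactorial-multichoose A (suc J))) ⟩
    suc J * A * (J ! * S A J) + c ^ suc J * (suc J ! * multichoose A (suc J)) ≡⟨ identity₂ (suc J) A (J !) (S A J) (c ^ suc J) (multichoose A (suc J)) ⟩
    suc J ! * S A (suc J) ∎
    where
    open ≤-Reasoning
    E = expScaled c J
    identity₁ : ∀ j E C A P → (j * E + C) * (A * P) ≡ j * A * (E * P) + C * (A * P)
    identity₁ = solve-∀
    identity₂ : ∀ j A f S C W → j * A * (f * S) + C * ((j * f) * W) ≡ (j * f) * (A * S + W * C)
    identity₂ = solve-∀

  expScaled-bound : ∀ e → e + c ≡ A → ∀ J → expScaled c J * e ^ A * A ^ J ≤ J ! * A ^ A * A ^ J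
  expScaled-bound e eq J = begin
    expScaled c J * e ^ A * A ^ J ≡⟨ identity (expScaled c J) (e ^ A) (A ^ J) ⟩
    e ^ A * (expScaled c J * A ^ J) ≤⟨ *-monoʳ-≤ (e ^ A) (expScaled≤S J) ⟩
    e ^ A * (J ! * S A J) ≡⟨ identity₂ (e ^ A) (J !) (S A J) ⟩
    J ! * (e ^ A * S A J) ≤⟨ *-monoʳ-≤ (J !) (S-iterate e eq A J) ⟩
    J ! * (A ^ A * S 0 J) ≡⟨ cong (λ z → J ! * (A ^ A * z)) (S-zero J) ⟩
    J ! * (A ^ A * A ^ J) ≡⟨ sym (*-assoc (J !) _ _) ⟩
    J ! * A ^ A * A ^ J ∎
    where
    open ≤-Reasoning
    identity : ∀ x y z → x * y * z ≡ y * (x * z)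
    identity = solve-∀
    identity₂ : ∀ x y z → x * (y * z) ≡ y * (x * z)
    identity₂ = solve-∀


expScaled-zero : ∀ J → expScaled 0 J ≡ J !
expScaled-zero zero = refl
expScaled-zero (suc J) rewrite expScaled-zero J = +-identityʳ _

expAtLeast-positive : ∀ {x N} → 2 ≤ N → ExpAtLeast x N → 1 ≤ x
expAtLeast-positive {x} {N} 2≤N (J , h) = ≰⇒> λ x≤0 →
  <⇒≱ J!<NJ! (subst (N * J ! ≤_) (trans (cong (λ z → expScaled z J) (n≤0⇒n≡0 x≤0)) (expScaled-zero J)) h)
  where
  J!<NJ! : J ! < N * J !
  J!<NJ! = <-≤-trans (m<m+n (J !) (1≤n! J)) (≤-trans (≤-reflexive (cong (J ! +_) (sym (+-identityʳ (J !))))) (*-monoˡ-≤ (J !) 2≤N))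

-- (1 - 1/(w+1))^((w+1)c) ≤ e^(-c) ≤ 1/N.
expAtLeast⇒pow : ∀ {c N} w → ExpAtLeast c N → 1 ≤ c → N * w ^ (suc w * c) ≤ suc w ^ (suc w * c)
expAtLeast⇒pow {c} {N} w (J , h) c≥1 = *-cancelʳ-≤′ _ _ (c ^ A) (1≤m⇒1≤m^n c A c≥1) (begin
  N * w ^ A * c ^ A   ≡⟨ *-assoc N _ _ ⟩
  N * (w ^ A * c ^ A) ≡⟨ cong (N *_) (sym (^-distribʳ-* w c A)) ⟩
  N * e ^ A           ≤⟨ N*e^A≤A^A ⟩
  A ^ A               ≡⟨ ^-distribʳ-* (suc w) c A ⟩
  suc w ^ A * c ^ A   ∎)
  where
  open ≤-Reasoning
  A = suc w * c
  e = w * c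
  N*e^A≤A^A : N * e ^ A ≤ A ^ A
  N*e^A≤A^A = *-cancelʳ-≤′ _ _ _ (*-mono-≤ (1≤n! J) (1≤m⇒1≤m^n A J (*-mono-≤ {1} {suc w} (s≤s z≤n) c≥1))) (begin
    N * e ^ A * (J ! * A ^ J)     ≡⟨ reorder N (e ^ A) (J !) (A ^ J) ⟩
    N * J ! * e ^ A * A ^ J       ≤⟨ *-monoˡ-≤ (A ^ J) (*-monoˡ-≤ (e ^ A) h) ⟩
    expScaled c J * e ^ A * A ^ J ≤⟨ ExpSeries.expScaled-bound c A e (+-comm e c) J ⟩
    J ! * A ^ A * A ^ J           ≡⟨ reorder′ (J !) (A ^ A) (A ^ J) ⟩
    A ^ A * (J ! * A ^ J)         ∎)
    where
    reorder : ∀ x y z t → x * y * (z * t) ≡ x * z * y * t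
    reorder = solve-∀
    reorder′ : ∀ x y z → x * y * z ≡ y * (x * z)
    reorder′ = solve-∀

ratio-bound : ∀ u b a w d → u ≡ suc (d + 36) → w ≡ d + 36 → suc d ≡ b * 6 → u ≡ a * 6 → u ^ 36 * b ≤ a * w ^ 36
ratio-bound u b a w d e₁ e₂ e₃ e₄ = *-cancelʳ-≤′ _ _ 6 (s≤s z≤n) (subst₂ _≤_ (reorder (u ^ 36) b) (reorder′ a (w ^ 36)) h₂)
  where
  h₁ : u ^ 36 * suc d ≤ u * w ^ 36
  h₁ = subst₂ (λ U W → U ^ 36 * suc d ≤ U * W ^ 36) (sym e₁) (sym e₂) (bernoulli-shift d 36)
  h₂ : u ^ 36 * (b * 6) ≤ (a * 6) * w ^ 36
  h₂ = subst₂ (λ S U → u ^ 36 * S ≤ U * w ^ 36) e₃ e₄ h₁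
  reorder : ∀ X b → X * (b * 6) ≡ X * b * 6
  reorder = solve-∀
  reorder′ : ∀ a Y → a * 6 * Y ≡ a * Y * 6
  reorder′ = solve-∀

ratio-bound-^ : ∀ u b a w L → u ^ 36 * b ≤ a * w ^ 36 → u ^ (36 * L) * b ^ L ≤ a ^ L * w ^ (36 * L)
ratio-bound-^ u b a w L b1 = begin
  u ^ (36 * L) * b ^ L  ≡⟨ cong (_* b ^ L) (sym (^-*-assoc u 36 L)) ⟩
  (u ^ 36) ^ L * b ^ L  ≡⟨ sym (^-distribʳ-* (u ^ 36) b L) ⟩
  (u ^ 36 * b) ^ L      ≤⟨ ^-monoˡ-≤ L b1 ⟩
  (a * w ^ 36) ^ L      ≡⟨ ^-distribʳ-* a (w ^ 36) L ⟩
  a ^ L * (w ^ 36) ^ L  ≡⟨ cong (a ^ L *_) (^-*-assoc w 36 L) ⟩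
  a ^ L * w ^ (36 * L)  ∎
  where open ≤-Reasoning

ratio-power-chain : ∀ {N w u A b a L} → 1 ≤ w → A * 6 ≡ 36 * L →
  N * w ^ A ≤ u ^ A → u ^ 36 * b ≤ a * w ^ 36 → N ^ 6 * b ^ L ≤ a ^ L
ratio-power-chain {N} {w} {u} {A} {b} {a} {L} w≥1 A*6≡36*L Nwᴬ≤uᴬ ratio = *-cancelʳ-≤′ _ _ _ (1≤m⇒1≤m^n w (36 * L) w≥1) (begin
  N ^ 6 * b ^ L * w ^ (36 * L) ≡⟨ reorder (N ^ 6) (b ^ L) (w ^ (36 * L)) ⟩
  N ^ 6 * w ^ (36 * L) * b ^ L ≤⟨ *-monoˡ-≤ (b ^ L) N⁶w³⁶ᴸ≤u³⁶ᴸ ⟩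
  u ^ (36 * L) * b ^ L         ≤⟨ ratio-bound-^ u b a w L ratio ⟩
  a ^ L * w ^ (36 * L)         ∎)
  where
  open ≤-Reasoning
  reorder : ∀ x y z → x * y * z ≡ x * z * y
  reorder = solve-∀
  N⁶w³⁶ᴸ≤u³⁶ᴸ : N ^ 6 * w ^ (36 * L) ≤ u ^ (36 * L)
  N⁶w³⁶ᴸ≤u³⁶ᴸ = begin
    N ^ 6 * w ^ (36 * L) ≡⟨ cong (N ^ 6 *_) (trans (cong (w ^_) (sym A*6≡36*L)) (sym (^-*-assoc w A 6))) ⟩
    N ^ 6 * (w ^ A) ^ 6  ≡⟨ sym (^-distribʳ-* N (w ^ A) 6) ⟩
    (N * w ^ A) ^ 6      ≤⟨ ^-monoˡ-≤ 6 Nwᴬ≤uᴬ ⟩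
    (u ^ A) ^ 6          ≡⟨ trans (^-*-assoc u A 6) (cong (u ^_) A*6≡36*L) ⟩
    u ^ (36 * L)         ∎

-- With u = 42n: (7n-6)/(7n) ≤ (1 - 1/u)^36 (ratio-bound) and (1 - 1/u)^(uqm) ≤ e^(-qm) ≤ n^(-pn)
-- (expAtLeast⇒pow); the sixth power of the latter gives the claim after taking n-th roots.
density⇒ratio-bound : ∀ p q n' m → 1 ≤ p → 1 ≤ n' → DensityAtLeast p q (suc n') m →
  suc n' ^ (6 * p) * (7 * n' + 1) ^ (7 * q * m) ≤ (7 * suc n') ^ (7 * q * m)
density⇒ratio-bound p q n' m p≥1 n'≥1 dens = ^-monoˡ-≤⁻¹ n _ _ (s≤s z≤n) (begin
  (n ^ (6 * p) * b ^ (7 * q * m)) ^ n       ≡⟨ ^-distribʳ-* (n ^ (6 * p)) _ n ⟩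
  (n ^ (6 * p)) ^ n * (b ^ (7 * q * m)) ^ n ≡⟨ cong₂ _*_ nᵉ≡ bᵉ≡ ⟩
  (n ^ (p * n)) ^ 6 * b ^ L                 ≤⟨ ratio-power-chain {n ^ (p * n)} {w} {u} {A} {b} {a} {L} (≤-trans (s≤s (z≤n {40})) (m≤n+m 41 (42 * n'))) A*6≡36*L Nwᴬ≤uᴬ u³⁶b≤aw³⁶ ⟩
  a ^ L                                     ≡⟨ trans (cong (a ^_) (sym (e₂ q m n))) (sym (^-*-assoc a (7 * q * m) n)) ⟩
  (a ^ (7 * q * m)) ^ n                     ∎)
  where
  open ≤-Reasoning
  n = suc n'
  c = q * m
  a = 7 * n
  b = 7 * n' + 1
  u = 42 * n
  w = 42 * n' + 41
  A = u * c
  L = 7 * n * c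
  e₁ : ∀ p n → 6 * p * n ≡ p * n * 6
  e₁ = solve-∀
  e₂ : ∀ q m n → 7 * q * m * n ≡ 7 * n * (q * m)
  e₂ = solve-∀
  nᵉ≡ : (n ^ (6 * p)) ^ n ≡ (n ^ (p * n)) ^ 6
  nᵉ≡ = trans (^-*-assoc n (6 * p) n) (trans (cong (n ^_) (e₁ p n)) (sym (^-*-assoc n (p * n) 6)))
  bᵉ≡ : (b ^ (7 * q * m)) ^ n ≡ b ^ L
  bᵉ≡ = trans (^-*-assoc b (7 * q * m) n) (cong (b ^_) (e₂ q m n))
  A*6≡36*L : A * 6 ≡ 36 * L
  A*6≡36*L = e n c
    where
    e : ∀ n c → 42 * n * c * 6 ≡ 36 * (7 * n * c)
    e = solve-∀
  2≤n^pn : 2 ≤ n ^ (p * n)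
  2≤n^pn = ≤-trans (≤-trans (s≤s n'≥1) (≤-reflexive (sym (*-identityʳ n))))
    (^-monoʳ-≤′ n (s≤s z≤n) (≤-trans (s≤s z≤n) (*-mono-≤ p≥1 (s≤s (z≤n {n'})))))
  u³⁶b≤aw³⁶ : u ^ 36 * b ≤ a * w ^ 36
  u³⁶b≤aw³⁶ = ratio-bound u b a w (42 * n' + 5) (e₃ n') (e₄ n') (e₅ n') (e₆ n')
    where
    e₃ : ∀ n' → 42 * suc n' ≡ suc (42 * n' + 5 + 36)
    e₃ = solve-∀
    e₄ : ∀ n' → 42 * n' + 41 ≡ 42 * n' + 5 + 36
    e₄ = solve-∀
    e₅ : ∀ n' → suc (42 * n' + 5) ≡ (7 * n' + 1) * 6
    e₅ = solve-∀
    e₆ : ∀ n' → 42 * suc n' ≡ 7 * suc n' * 6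
    e₆ = solve-∀
  Nwᴬ≤uᴬ : n ^ (p * n) * w ^ A ≤ u ^ A
  Nwᴬ≤uᴬ = subst (λ v → n ^ (p * n) * w ^ (v * c) ≤ v ^ (v * c)) (e n')
    (expAtLeast⇒pow {N = n ^ (p * n)} w dens (expAtLeast-positive 2≤n^pn dens))
    where
    e : ∀ n' → suc (42 * n' + 41) ≡ 42 * suc n'
    e = solve-∀


halving-block : ∀ q n' → 1 ≤ q → 2 * (7 * n' + 1) ^ (7 * q * suc n') ≤ (7 * suc n') ^ (7 * q * suc n')
halving-block (suc q') n' _ = begin
  2 * b ^ k ≡⟨ cong (b ^ k +_) (+-identityʳ (b ^ k)) ⟩
  b ^ k + b ^ k ≡⟨ cong (λ z → b ^ k + b ^ z) keq ⟩
  b ^ k + b * b ^ k' ≤⟨ +-monoʳ-≤ (b ^ k) (*-monoˡ-≤ (b ^ k') bk) ⟩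
  b ^ k + k * 6 * b ^ k' ≡⟨ cong (b ^ k +_) (trans (*-assoc k 6 (b ^ k')) (cong (λ z → k * (6 * b ^ z)) (cong (_∸ 1) (sym keq)))) ⟩
  b ^ k + k * (6 * b ^ (k ∸ 1)) ≤⟨ bernoulli k b 6 ⟩
  (b + 6) ^ k ≡⟨ cong (_^ k) (identity n') ⟩
  (7 * suc n') ^ k ∎
  where
  open ≤-Reasoning
  b = 7 * n' + 1
  k' = 6 * suc n' + 7 * q' * suc n' + n'
  k = 7 * suc q' * suc n'
  keq : k ≡ suc k'
  keq = identity₂ q' n'
    where
    identity₂ : ∀ q' n' → 7 * suc q' * suc n' ≡ suc (6 * suc n' + 7 * q' * suc n' + n')
    identity₂ = solve-∀
  bk : b ≤ k * 6
  bk = subst (b ≤_) (identity₃ q' n') (m≤m+n (7 * n' + 1) (35 * n' + 41 + 42 * q' * suc n'))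
    where
    identity₃ : ∀ q' n' → 7 * n' + 1 + (35 * n' + 41 + 42 * q' * suc n') ≡ 7 * suc q' * suc n' * 6
    identity₃ = solve-∀
  identity : ∀ n' → 7 * n' + 1 + 6 ≡ 7 * suc n'
  identity = solve-∀

halving-blocks : ∀ a b K n m r0 j → m ≡ r0 + j * n → b ≤ a → 2 * b ^ (K * n) ≤ a ^ (K * n) → 2 ^ j * b ^ (K * m) ≤ a ^ (K * m)
halving-blocks a b K n m r0 j me ba h rewrite me = begin
  2 ^ j * b ^ (K * (r0 + j * n)) ≡⟨ cong (λ z → 2 ^ j * b ^ z) (ex K r0 j n) ⟩
  2 ^ j * b ^ (K * r0 + K * n * j) ≡⟨ cong (2 ^ j *_) (trans (^-distribˡ-+-* b (K * r0) (K * n * j)) (cong (b ^ (K * r0) *_) (sym (^-*-assoc b (K * n) j)))) ⟩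
  2 ^ j * (b ^ (K * r0) * (b ^ (K * n)) ^ j) ≡⟨ identity (2 ^ j) (b ^ (K * r0)) ((b ^ (K * n)) ^ j) ⟩
  b ^ (K * r0) * (2 ^ j * (b ^ (K * n)) ^ j) ≡⟨ cong (b ^ (K * r0) *_) (sym (^-distribʳ-* 2 (b ^ (K * n)) j)) ⟩
  b ^ (K * r0) * (2 * b ^ (K * n)) ^ j ≤⟨ *-mono-≤ (^-monoˡ-≤ (K * r0) ba) (^-monoˡ-≤ j h) ⟩
  a ^ (K * r0) * (a ^ (K * n)) ^ j ≡⟨ cong (a ^ (K * r0) *_) (^-*-assoc a (K * n) j) ⟩
  a ^ (K * r0) * a ^ (K * n * j) ≡⟨ sym (^-distribˡ-+-* a (K * r0) (K * n * j)) ⟩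
  a ^ (K * r0 + K * n * j) ≡⟨ cong (a ^_) (sym (ex K r0 j n)) ⟩
  a ^ (K * (r0 + j * n)) ∎
  where
  open ≤-Reasoning
  ex : ∀ K r0 j n → K * (r0 + j * n) ≡ K * r0 + K * n * j
  ex = solve-∀
  identity : ∀ x y z → x * (y * z) ≡ y * (x * z)
  identity = solve-∀

module PolyVsExp (C₀ E : ℕ) where
  r : ℕ
  r = suc E

  G₀ : ℕ
  G₀ = C₀ * (r + 2) ^ E

  N₀ : ℕ
  N₀ = C₀ * (r * G₀ + 2) ^ E

  poly≤2^ : ∀ j → G₀ ≤ suc (j / r) → C₀ * (j + 2) ^ E ≤ 2 ^ j
  poly≤2^ j G₀≤ = begin
    C₀ * (j + 2) ^ E           ≤⟨ *-monoʳ-≤ C₀ (^-monoˡ-≤ E j+2≤) ⟩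
    C₀ * ((r + 2) * suc i) ^ E ≡⟨ trans (cong (C₀ *_) (^-distribʳ-* (r + 2) (suc i) E)) (sym (*-assoc C₀ _ _)) ⟩
    G₀ * suc i ^ E             ≤⟨ *-monoˡ-≤ (suc i ^ E) G₀≤ ⟩
    suc i * suc i ^ E          ≤⟨ suc[/]^≤2^ j r ⟩
    2 ^ j                      ∎
    where
    open ≤-Reasoning
    i = j / r
    j+2≤ : j + 2 ≤ (r + 2) * suc i
    j+2≤ = begin
      j + 2                 ≤⟨ +-monoˡ-≤ 2 (<⇒≤ (m<[1+m/n]*n j r)) ⟩
      suc i * r + 2         ≤⟨ +-monoʳ-≤ (suc i * r) (m≤m*n 2 (suc i)) ⟩
      suc i * r + 2 * suc i ≡⟨ e r i ⟩
      (r + 2) * suc i       ∎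
      where
      e : ∀ r i → suc i * r + 2 * suc i ≡ (r + 2) * suc i
      e = solve-∀

  poly≤N₀ : ∀ j → ¬ G₀ ≤ suc (j / r) → C₀ * (j + 2) ^ E ≤ N₀
  poly≤N₀ j small = *-monoʳ-≤ C₀ (^-monoˡ-≤ E (+-monoˡ-≤ 2 (begin
    j               ≤⟨ <⇒≤ (m<[1+m/n]*n j r) ⟩
    suc (j / r) * r ≤⟨ *-monoˡ-≤ r (<⇒≤ (≰⇒> small)) ⟩
    G₀ * r          ≡⟨ *-comm G₀ r ⟩
    r * G₀          ∎)))
    where open ≤-Reasoning

  poly≤exp-or-linear : ∀ X Y n j → 2 ^ j * Y ≤ X → n * Y ≤ X → N₀ ≤ n → C₀ * (j + 2) ^ E * Y ≤ X
  poly≤exp-or-linear X Y n j 2^jY≤X nY≤X N₀≤n with G₀ ≤? suc (j / r)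
  ... | yes big  = ≤-trans (*-monoˡ-≤ Y (poly≤2^ j big)) 2^jY≤X
  ... | no small = ≤-trans (*-monoˡ-≤ Y (≤-trans (poly≤N₀ j small) N₀≤n)) nY≤X

^-root-mean : ∀ P' K {B t F Y X n} → K ≤ P' → 1 ≤ n →
  B ^ suc P' * t ^ (F * suc P') * Y ≤ X → n ^ suc P' * Y ≤ X → B * n ^ K * t ^ F * Y ≤ X
^-root-mean P' K {B} {t} {F} {Y} {X} {n} K≤P' n≥1 CTY≤X nᴾY≤X = ^-monoˡ-≤⁻¹ P (B * n ^ K * t ^ F * Y) X (s≤s z≤n) (begin
  (B * n ^ K * t ^ F * Y) ^ P           ≡⟨ expand ⟩
  C * n ^ (K * P) * T * Y ^ P           ≤⟨ *-monoˡ-≤ (Y ^ P) (*-monoˡ-≤ T (*-monoʳ-≤ C (^-monoʳ-≤′ n n≥1 KP≤PP'))) ⟩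
  C * n ^ (P * P') * T * (Y * Y ^ P')   ≡⟨ regroup C (n ^ (P * P')) T Y (Y ^ P') ⟩
  (C * T * Y) * (n ^ (P * P') * Y ^ P') ≡⟨ cong (λ z → (C * T * Y) * (z * Y ^ P')) (sym (^-*-assoc n P P')) ⟩
  (C * T * Y) * ((n ^ P) ^ P' * Y ^ P') ≡⟨ cong ((C * T * Y) *_) (sym (^-distribʳ-* (n ^ P) Y P')) ⟩
  (C * T * Y) * (n ^ P * Y) ^ P'        ≤⟨ *-mono-≤ CTY≤X (^-monoˡ-≤ P' nᴾY≤X) ⟩
  X * X ^ P'                            ∎)
  where
  open ≤-Reasoning
  P = suc P'
  C = B ^ P
  T = t ^ (F * P)
  KP≤PP' : K * P ≤ P * P'
  KP≤PP' = ≤-trans (*-monoˡ-≤ P K≤P') (≤-reflexive (*-comm P' P))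
  regroup : ∀ c t u y w → c * t * u * (y * w) ≡ (c * u * y) * (t * w)
  regroup = solve-∀
  expand : (B * n ^ K * t ^ F * Y) ^ P ≡ C * n ^ (K * P) * T * Y ^ P
  expand = begin-equality
    (B * n ^ K * t ^ F * Y) ^ P             ≡⟨ ^-distribʳ-* (B * n ^ K * t ^ F) Y P ⟩
    (B * n ^ K * t ^ F) ^ P * Y ^ P         ≡⟨ cong (_* Y ^ P) (^-distribʳ-* (B * n ^ K) (t ^ F) P) ⟩
    (B * n ^ K) ^ P * (t ^ F) ^ P * Y ^ P   ≡⟨ cong (λ z → z * (t ^ F) ^ P * Y ^ P) (^-distribʳ-* B (n ^ K) P) ⟩
    C * (n ^ K) ^ P * (t ^ F) ^ P * Y ^ P   ≡⟨ cong₂ (λ u v → C * u * v * Y ^ P) (^-*-assoc n K P) (^-*-assoc t F P) ⟩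
    C * n ^ (K * P) * T * Y ^ P             ∎

^-root-product : ∀ K {A n t D b a m} → 1 ≤ K →
  A ^ K * n ^ K * t ^ (K * D) * b ^ (K * m) ≤ a ^ (K * m) → A * n * t ^ D * b ^ m ≤ a ^ m
^-root-product K {A} {n} {t} {D} {b} {a} {m} K≥1 h = ^-monoˡ-≤⁻¹ K _ (a ^ m) K≥1 (begin
  (A * n * t ^ D * b ^ m) ^ K               ≡⟨ ^-distribʳ-* (A * n * t ^ D) (b ^ m) K ⟩
  (A * n * t ^ D) ^ K * (b ^ m) ^ K         ≡⟨ cong (_* (b ^ m) ^ K) (^-distribʳ-* (A * n) (t ^ D) K) ⟩
  (A * n) ^ K * (t ^ D) ^ K * (b ^ m) ^ K   ≡⟨ cong (λ z → z * (t ^ D) ^ K * (b ^ m) ^ K) (^-distribʳ-* A n K) ⟩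
  A ^ K * n ^ K * (t ^ D) ^ K * (b ^ m) ^ K ≡⟨ cong₂ (λ u v → A ^ K * n ^ K * u * v) (trans (^-*-assoc t D K) (cong (t ^_) (*-comm D K))) (trans (^-*-assoc b m K) (cong (b ^_) (*-comm m K))) ⟩
  A ^ K * n ^ K * t ^ (K * D) * b ^ (K * m) ≤⟨ h ⟩
  a ^ (K * m)                               ≡⟨ trans (cong (a ^_) (*-comm K m)) (sym (^-*-assoc a m K)) ⟩
  (a ^ m) ^ K                               ∎)
  where open ≤-Reasoning

n+suc[m]≤n*[m/n+2] : ∀ n m .{{_ : NonZero n}} → n + suc m ≤ n * (m / n + 2)
n+suc[m]≤n*[m/n+2] n m = begin
  n + suc m             ≤⟨ +-monoʳ-≤ n (m<[1+m/n]*n m n) ⟩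
  n + suc (m / n) * n   ≡⟨ e n (m / n) ⟩
  n * (m / n + 2)       ∎
  where
  open ≤-Reasoning
  e : ∀ n j → n + suc j * n ≡ n * (j + 2)
  e = solve-∀

-- Write m = m % n + j·n.  The factor ((7n-6)/(7n))^(7qm) is at most 2^(-j) (halving-blocks) and at
-- most n^(-6p) (density⇒ratio-bound): the first absorbs the polynomial in j, the second the
-- powers of n, since 7q ≤ 6p - 1.
density⇒dominates : ∀ p q → 1 ≤ q → 7 * q < 6 * p → ∀ A₀ D → ∃ λ N → ∀ n' m → N ≤ n' → DensityAtLeast p q (suc n') m →
  A₀ * suc n' * (suc n' + suc m) ^ D * (7 * n' + 1) ^ m ≤ suc n' ^ D * (7 * suc n') ^ m
density⇒dominates zero q q≥1 () A₀ D
density⇒dominates (suc p') q q≥1 7q<6p A₀ D = suc N₀ , bound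
  where
  K = 7 * q
  P' = p' + 5 * suc p'
  open PolyVsExp ((A₀ ^ K) ^ (6 * suc p')) (K * D * (6 * suc p')) using (N₀; poly≤exp-or-linear)
  bound : ∀ n' m → suc N₀ ≤ n' → DensityAtLeast (suc p') q (suc n') m →
    A₀ * suc n' * (suc n' + suc m) ^ D * (7 * n' + 1) ^ m ≤ suc n' ^ D * (7 * suc n') ^ m
  bound n' m N₀<n' dens = begin
    A₀ * n * (n + suc m) ^ D * b ^ m      ≤⟨ *-monoˡ-≤ (b ^ m) (*-monoʳ-≤ (A₀ * n) (^-monoˡ-≤ D (n+suc[m]≤n*[m/n+2] n m))) ⟩
    A₀ * n * (n * (j + 2)) ^ D * b ^ m    ≡⟨ cong (λ z → A₀ * n * z * b ^ m) (^-distribʳ-* n (j + 2) D) ⟩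
    A₀ * n * (n ^ D * (j + 2) ^ D) * b ^ m ≡⟨ regroup A₀ n (n ^ D) ((j + 2) ^ D) (b ^ m) ⟩
    n ^ D * (A₀ * n * (j + 2) ^ D * b ^ m) ≤⟨ *-monoʳ-≤ (n ^ D) (^-root-product K {A₀} {n} {j + 2} {D} {b} {a} {m} (≤-trans q≥1 (m≤n*m q 7))
      (^-root-mean P' K {A₀ ^ K} {j + 2} {K * D} (s≤s⁻¹ 7q<6p) (s≤s z≤n) polyY≤X ratio)) ⟩
    n ^ D * a ^ m                          ∎
    where
    open ≤-Reasoning
    n = suc n'
    a = 7 * n
    b = 7 * n' + 1
    j = m / n
    X = a ^ (K * m)
    Y = b ^ (K * m)
    regroup : ∀ A n N J B → A * n * (N * J) * B ≡ N * (A * n * J * B)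
    regroup = solve-∀
    ratio : n ^ (6 * suc p') * Y ≤ X
    ratio = density⇒ratio-bound (suc p') q n' m (s≤s z≤n) (≤-trans (s≤s z≤n) N₀<n') dens
    b≤a : b ≤ a
    b≤a = subst (b ≤_) (e n') (m≤m+n b 6)
      where
      e : ∀ n' → 7 * n' + 1 + 6 ≡ 7 * suc n'
      e = solve-∀
    halving : 2 ^ j * Y ≤ X
    halving = halving-blocks a b K n m (m % n) j (m≡m%n+[m/n]*n m n) b≤a (halving-block q n' q≥1)
    nY≤X : n * Y ≤ X
    nY≤X = ≤-trans (*-monoˡ-≤ Y (≤-trans (≤-reflexive (sym (*-identityʳ n))) (^-monoʳ-≤′ n (s≤s z≤n) (s≤s (z≤n {P'}))))) ratio
    polyY≤X : (A₀ ^ K) ^ (6 * suc p') * (j + 2) ^ (K * D * (6 * suc p')) * Y ≤ X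
    polyY≤X = poly≤exp-or-linear X Y n j halving nY≤X (≤-trans (n≤1+n N₀) (≤-trans N₀<n' (n≤1+n n')))


-- Union bound

module BadPairs (n m d1 d2 : ℕ) where
  pairEvent : Fin n → Fin n → Formula n m → Bool
  pairEvent x y φ = not (x == y) ∧ any (λ k → any (λ E → PathEvent x y d1 d1 E φ) (paths x y k)) (oneTo d2)

  badEvent⇒pairEvent : ∀ φ → badEvent d1 d2 φ ≡ true → any (λ x → any (λ y → pairEvent x y φ) (allFinL n)) (allFinL n) ≡ true
  badEvent⇒pairEvent φ h = any-mono _ _ (allFinL n) (λ x hx → any-mono _ _ (allFinL n) (λ y hy → pairEvent-intro x y hy) hx) h
    where
    pairEvent-intro : ∀ x y → (not (x == y) ∧ (isolated d1 φ x ∧ (isolated d1 φ y ∧ withinDist φ d2 x y))) ≡ true → pairEvent x y φ ≡ true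
    pairEvent-intro x y hy with ShortestPath.pathCertificate φ x d2 y close (trans (sym (not-involutive (x == y))) (cong not x≢y))
      where
      x≢y = ∧-elimˡ {not (x == y)} hy
      close = ∧-elimʳ {isolated d1 φ y} (∧-elimʳ {isolated d1 φ x} (∧-elimʳ {not (x == y)} hy))
    ... | k , k≥1 , k≤d2 , good = ∧-intro (∧-elimˡ {not (x == y)} hy) (any-∈ _ (∈-oneTo k d2 k≥1 k≤d2)
      (any-mono _ _ (paths x y k) (λ E gE → ∧-intro isoˣ (∧-intro isoʸ (∧-intro (ShortestPath.goodPath-allCovered φ x k E gE)
        (ShortestPath.goodPath-noDoubleCover φ x k E gE)))) good))
      where
      isoˣ = ∧-elimˡ {isolated d1 φ x} (∧-elimʳ {not (x == y)} hy)
      isoʸ = ∧-elimˡ {isolated d1 φ y} (∧-elimʳ {isolated d1 φ x} (∧-elimʳ {not (x == y)} hy))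

  countF-badEvent≤ : countF n m (badEvent d1 d2) ≤ sum (map (λ x → sum (map (λ y → countF n m (pairEvent x y)) (allFinL n))) (allFinL n))
  countF-badEvent≤ = ≤-trans (countF-mono n m _ _ badEvent⇒pairEvent)
    (≤-trans (countF-any n m (λ x φ → any (λ y → pairEvent x y φ) (allFinL n)) (allFinL n))
      (sum-map-mono _ _ (allFinL n) (λ x → countF-any n m (λ y φ → pairEvent x y φ) (allFinL n))))

  countF-pairEvent : ∀ x y → (x == y) ≡ false →
    countF n m (pairEvent x y) ≤ sum (map (λ k → sum (map (λ E → countF n m (PathEvent x y d1 d1 E)) (paths x y k))) (oneTo d2))
  countF-pairEvent x y e = ≤-trans (countF-mono n m _ _ (λ φ h → subst (λ b → not b ∧ any (λ k → any (λ E → PathEvent x y d1 d1 E φ) (paths x y k)) (oneTo d2) ≡ true) e h))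
    (≤-trans (countF-any n m (λ k φ → any (λ E → PathEvent x y d1 d1 E φ) (paths x y k)) (oneTo d2))
      (sum-map-mono _ _ (oneTo d2) (λ k → countF-any n m (λ E φ → PathEvent x y d1 d1 E φ) (paths x y k))))

  countF-pairEvent-same : ∀ x y → (x == y) ≡ true → countF n m (pairEvent x y) ≡ 0
  countF-pairEvent-same x y e = countF-false n m _ (λ φ → cong (λ b → not b ∧ any (λ k → any (λ E → PathEvent x y d1 d1 E φ) (paths x y k)) (oneTo d2)) e)


-- Here n = t + 2; t ≥ 25 is what n³ ≤ R0 needs.
module Assembly (t m d1 d2 : ℕ) (25≤t : 25 ≤ t) where
  open ClauseCounts t public
  α : ℕ
  α = 42 * n
  M' : ℕ
  M' = n + suc m
  D : ℕ
  D = d1 + d1 + d2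
  Y0 : ℕ
  Y0 = 42 * M' * R0

  covers≤α : ∀ (e : Edge n) → countᵇ (covers e) L ≤ α
  covers≤α (u , w) = countᵇ-covers-allClauses n u w

  posPMM≤β : ∀ (x : Fin n) → countᵇ (posPMM x) L ≤ β
  posPMM≤β x = ≤-reflexive (countᵇ-posPMM-allClauses n' x)

  countF-pathEvent-R0 : ∀ (x y : Fin n) → (x == y) ≡ false → ∀ E → countF n m (PathEvent x y d1 d1 E) * R0 ^ (d1 + d1 + length E) ≤ Weight.weight α R0 β m d1 d1 (length E)
  countF-pathEvent-R0 x y e E = subst (λ R → countF n m (PathEvent x y d1 d1 E) * R ^ (d1 + d1 + length E) ≤ Weight.weight α R β m d1 d1 (length E)) (countᵇ-neitherPMM x y e)
    (IsolatedPaths.countF-pathEvent n x y α β covers≤α (posPMM≤β x) (posPMM≤β y) m d1 d1 E)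

  n³≤R0′ : n * n * n ≤ R0
  n³≤R0′ = n³≤R0 (s≤s 25≤t)

  n≤M' : n ≤ M'
  n≤M' = m≤m+n n (suc m)

  edgeFactor≤Y0 : suc m * α * n * n ≤ Y0
  edgeFactor≤Y0 = begin
    suc m * (42 * n) * n * n ≡⟨ identity (suc m) n ⟩
    42 * suc m * (n * n * n) ≤⟨ *-mono-≤ (*-monoʳ-≤ 42 (m≤n+m (suc m) n)) n³≤R0′ ⟩
    42 * M' * R0 ∎
    where
    open ≤-Reasoning
    identity : ∀ a n → a * (42 * n) * n * n ≡ 42 * a * (n * n * n)
    identity = solve-∀

  nR0≤Y0 : n * R0 ≤ Y0
  nR0≤Y0 = begin
    n * R0 ≤⟨ *-monoˡ-≤ R0 n≤M' ⟩
    M' * R0 ≤⟨ ≤-reflexive (sym (*-identityˡ (M' * R0))) ⟩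
    1 * (M' * R0) ≤⟨ *-monoˡ-≤ (M' * R0) (s≤s (z≤n {41})) ⟩
    42 * (M' * R0) ≡⟨ sym (*-assoc 42 M' R0) ⟩
    Y0 ∎
    where open ≤-Reasoning

  isolationFactor≤Y0 : n * (R0 + m * β) ≤ Y0
  isolationFactor≤Y0 = begin
    n * (R0 + m * β) ≡⟨ identity n R0 m β ⟩
    n * R0 + m * (n * β) ≤⟨ +-mono-≤ (*-monoˡ-≤ R0 n≤M') (*-mono-≤ m≤M' (≤-trans (*-monoʳ-≤ n β≤n²) (≤-trans (≤-reflexive (sym (*-assoc n n n))) n³≤R0′))) ⟩
    M' * R0 + M' * R0 ≡⟨ identity₂ M' R0 ⟩
    2 * (M' * R0) ≤⟨ *-monoˡ-≤ (M' * R0) (s≤s (s≤s (z≤n {40}))) ⟩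
    42 * (M' * R0) ≡⟨ sym (*-assoc 42 M' R0) ⟩
    Y0 ∎
    where
    open ≤-Reasoning
    m≤M' : m ≤ M'
    m≤M' = ≤-trans (n≤1+n m) (m≤n+m (suc m) n)
    identity : ∀ n R m b → n * (R + m * b) ≡ n * R + m * (n * b)
    identity = solve-∀
    identity₂ : ∀ a b → a * b + a * b ≡ 2 * (a * b)
    identity₂ = solve-∀

  K : ℕ
  K = (n * R0) ^ D
  C : ℕ
  C = Y0 ^ D * R0 ^ m

  pathEvent-bound : ∀ (x y : Fin n) → (x == y) ≡ false → ∀ k E → length E ≡ k → k ≤ d2 →
    n ^ k * (countF n m (PathEvent x y d1 d1 E) * K) ≤ C
  pathEvent-bound x y e k E le kd = weight⇒bound (countF n m (PathEvent x y d1 d1 E)) n m R0 β α Y0 k d1 d2 kd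
    (subst (λ z → countF n m (PathEvent x y d1 d1 E) * R0 ^ (d1 + d1 + z) ≤ Weight.weight α R0 β m d1 d1 z) le (countF-pathEvent-R0 x y e E)) edgeFactor≤Y0 isolationFactor≤Y0 nR0≤Y0

  pathMass : Fin n → Fin n → ℕ → ℕ
  pathMass x y k = 𝟙 (not (x == y)) * sum (map (λ E → countF n m (PathEvent x y d1 d1 E) * K) (paths x y k))

  pathMass-bound : ∀ x y k → k ≤ d2 → n ^ k * pathMass x y k ≤ length (paths x y k) * C
  pathMass-bound x y k kd = go (x == y) refl
    where
    S = sum (map (λ E → countF n m (PathEvent x y d1 d1 E) * K) (paths x y k))
    go : ∀ b → (x == y) ≡ b → n ^ k * pathMass x y k ≤ length (paths x y k) * C
    go true e rewrite e = ≤-trans (≤-reflexive (*-zeroʳ (n ^ k))) z≤n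
    go false e rewrite e = begin
      n ^ k * (1 * S) ≡⟨ cong (n ^ k *_) (*-identityˡ S) ⟩
      n ^ k * S ≡⟨ sum-map-*ˡ _ (n ^ k) (paths x y k) ⟩
      sum (map (λ E → n ^ k * (countF n m (PathEvent x y d1 d1 E) * K)) (paths x y k))
        ≤⟨ sum-map-mono-∈ _ (λ _ → C) (paths x y k) (λ E mem → pathEvent-bound x y e k E (length-∈-paths x y k E mem) kd) ⟩
      sum (map (λ _ → C) (paths x y k)) ≡⟨ sum-map-const C (paths x y k) ⟩
      length (paths x y k) * C ∎
      where open ≤-Reasoning

  sum-allFin-const : ∀ c → sum (map (λ (_ : Fin n) → c) (allFinL n)) ≡ n * c
  sum-allFin-const c = trans (sum-map-allFin n (λ _ → c)) (sumFin-const n c)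

  sum-pathMass≤ : ∀ k → k ≤ d2 → sum (map (λ x → sum (map (λ y → pathMass x y k) (allFinL n))) (allFinL n)) ≤ n * C
  sum-pathMass≤ k kd = *-cancelʳ-≤′ _ _ (n ^ k) (1≤m⇒1≤m^n n k (s≤s z≤n)) (begin
    SS * n ^ k ≡⟨ *-comm SS (n ^ k) ⟩
    n ^ k * SS ≡⟨ sum-map-*ˡ _ (n ^ k) (allFinL n) ⟩
    sum (map (λ x → n ^ k * sum (map (λ y → pathMass x y k) (allFinL n))) (allFinL n))
      ≡⟨ cong sum (map-cong (λ x → sum-map-*ˡ _ (n ^ k) (allFinL n)) (allFinL n)) ⟩
    sum (map (λ x → sum (map (λ y → n ^ k * pathMass x y k) (allFinL n))) (allFinL n))
      ≤⟨ sum-map-mono _ _ (allFinL n) (λ x → sum-map-mono _ _ (allFinL n) (λ y → pathMass-bound x y k kd)) ⟩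
    sum (map (λ x → sum (map (λ y → length (paths x y k) * C) (allFinL n))) (allFinL n))
      ≡⟨ cong sum (map-cong (λ x → trans (sym (sum-map-*ʳ (λ y → length (paths x y k)) C (allFinL n)))
           (cong (_* C) (trans (sum-map-allFin n (λ y → length (paths x y k))) (sum-length-paths x k)))) (allFinL n)) ⟩
    sum (map (λ x → n ^ k * C) (allFinL n)) ≡⟨ sum-allFin-const (n ^ k * C) ⟩
    n * (n ^ k * C) ≡⟨ identity n (n ^ k) C ⟩
    n * C * n ^ k ∎)
    where
    open ≤-Reasoning
    SS = sum (map (λ x → sum (map (λ y → pathMass x y k) (allFinL n))) (allFinL n))
    identity : ∀ a b c → a * (b * c) ≡ a * c * b
    identity = solve-∀

  open BadPairs n m d1 d2 using (pairEvent; countF-badEvent≤; countF-pairEvent; countF-pairEvent-same)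

  pairEvent-bound : ∀ x y → countF n m (pairEvent x y) * K ≤ sum (map (λ k → pathMass x y k) (oneTo d2))
  pairEvent-bound x y = go (x == y) refl
    where
    go : ∀ b → (x == y) ≡ b → countF n m (pairEvent x y) * K ≤ sum (map (λ k → pathMass x y k) (oneTo d2))
    go true e = ≤-trans (≤-reflexive (cong (_* K) (countF-pairEvent-same x y e))) z≤n
    go false e = begin
      countF n m (pairEvent x y) * K ≤⟨ *-monoˡ-≤ K (countF-pairEvent x y e) ⟩
      sum (map (λ k → sum (map (λ E → countF n m (PathEvent x y d1 d1 E)) (paths x y k))) (oneTo d2)) * K ≡⟨ sum-map-*ʳ (λ k → sum (map (λ E → countF n m (PathEvent x y d1 d1 E)) (paths x y k))) K (oneTo d2) ⟩
      sum (map (λ k → sum (map (λ E → countF n m (PathEvent x y d1 d1 E)) (paths x y k)) * K) (oneTo d2))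
        ≡⟨ cong sum (map-cong (λ k → trans (sum-map-*ʳ (λ E → countF n m (PathEvent x y d1 d1 E)) K (paths x y k))
             (sym (trans (cong (λ b → 𝟙 (not b) * sum (map (λ E → countF n m (PathEvent x y d1 d1 E) * K) (paths x y k))) e) (*-identityˡ _)))) (oneTo d2)) ⟩
      sum (map (λ k → pathMass x y k) (oneTo d2)) ∎
      where
      open ≤-Reasoning

  length-oneTo : ∀ d → length (oneTo d) ≡ d
  length-oneTo zero = refl
  length-oneTo (suc d) = cong suc (length-oneTo d)

  badEvent-mass≤ : countF n m (badEvent d1 d2) * K ≤ d2 * (n * C)
  badEvent-mass≤ = begin
    countF n m (badEvent d1 d2) * K ≤⟨ *-monoˡ-≤ K countF-badEvent≤ ⟩
    sum (map (λ x → sum (map (λ y → countF n m (pairEvent x y)) (allFinL n))) (allFinL n)) * K ≡⟨ sum-map-*ʳ (λ x → sum (map (λ y → countF n m (pairEvent x y)) (allFinL n))) K (allFinL n) ⟩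
    sum (map (λ x → sum (map (λ y → countF n m (pairEvent x y)) (allFinL n)) * K) (allFinL n))
      ≡⟨ cong sum (map-cong (λ x → sum-map-*ʳ (λ y → countF n m (pairEvent x y)) K (allFinL n)) (allFinL n)) ⟩
    sum (map (λ x → sum (map (λ y → countF n m (pairEvent x y) * K) (allFinL n))) (allFinL n))
      ≤⟨ sum-map-mono _ _ (allFinL n) (λ x → sum-map-mono _ _ (allFinL n) (λ y → pairEvent-bound x y)) ⟩
    sum (map (λ x → sum (map (λ y → sum (map (λ k → pathMass x y k) (oneTo d2))) (allFinL n))) (allFinL n))
      ≡⟨ cong sum (map-cong (λ x → sum-map-swap (λ y k → pathMass x y k) (allFinL n) (oneTo d2)) (allFinL n)) ⟩
    sum (map (λ x → sum (map (λ k → sum (map (λ y → pathMass x y k) (allFinL n))) (oneTo d2))) (allFinL n))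
      ≡⟨ sum-map-swap (λ x k → sum (map (λ y → pathMass x y k) (allFinL n))) (allFinL n) (oneTo d2) ⟩
    sum (map (λ k → sum (map (λ x → sum (map (λ y → pathMass x y k) (allFinL n))) (allFinL n))) (oneTo d2))
      ≤⟨ sum-map-mono-∈ _ (λ _ → n * C) (oneTo d2) (λ k mem → sum-pathMass≤ k (proj₂ (oneTo-∈ k d2 mem))) ⟩
    sum (map (λ _ → n * C) (oneTo d2)) ≡⟨ trans (sum-map-const (n * C) (oneTo d2)) (cong (_* (n * C)) (length-oneTo d2)) ⟩
    d2 * (n * C) ∎
    where
    open ≤-Reasoning

  badEvent-bound : ∀ k0 → (suc k0 * d2 * 42 ^ D) * n * M' ^ D * (7 * n' + 1) ^ m ≤ n ^ D * (7 * n) ^ m →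
    suc k0 * countF n m (badEvent d1 d2) ≤ T ^ m
  badEvent-bound k0 hA = *-cancelʳ-≤′ _ _ Z Zpos (begin
    suc k0 * bad * Z ≡⟨ cong (λ z → suc k0 * bad * (z * a ^ m)) (sym (^-distribʳ-* n R0 D)) ⟩
    suc k0 * bad * (K * a ^ m) ≡⟨ identity₀ (suc k0) bad K (a ^ m) ⟩
    suc k0 * (bad * K) * a ^ m ≤⟨ *-monoˡ-≤ (a ^ m) (*-monoʳ-≤ (suc k0) badEvent-mass≤) ⟩
    suc k0 * (d2 * (n * (Y0 ^ D * R0 ^ m))) * a ^ m ≡⟨ cong (λ z → suc k0 * (d2 * (n * (z * R0 ^ m))) * a ^ m) (trans (^-distribʳ-* (42 * M') R0 D) (cong (_* R0 ^ D) (^-distribʳ-* 42 M' D))) ⟩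
    suc k0 * (d2 * (n * (42 ^ D * M' ^ D * R0 ^ D * R0 ^ m))) * a ^ m ≡⟨ identity₁ (suc k0) d2 n (42 ^ D) (M' ^ D) (R0 ^ D) (R0 ^ m) (a ^ m) ⟩
    suc k0 * d2 * 42 ^ D * n * M' ^ D * R0 ^ D * (R0 ^ m * a ^ m) ≡⟨ cong (λ z → suc k0 * d2 * 42 ^ D * n * M' ^ D * R0 ^ D * z) Rm ⟩
    suc k0 * d2 * 42 ^ D * n * M' ^ D * R0 ^ D * (b ^ m * T ^ m) ≡⟨ identity₂ (suc k0 * d2 * 42 ^ D * n * M' ^ D) (R0 ^ D) (b ^ m) (T ^ m) ⟩
    (suc k0 * d2 * 42 ^ D * n * M' ^ D * b ^ m) * (R0 ^ D * T ^ m) ≤⟨ *-monoˡ-≤ (R0 ^ D * T ^ m) hA ⟩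
    (n ^ D * a ^ m) * (R0 ^ D * T ^ m) ≡⟨ identity₃ (n ^ D) (a ^ m) (R0 ^ D) (T ^ m) ⟩
    T ^ m * Z ∎)
    where
    open ≤-Reasoning
    bad = countF n m (badEvent d1 d2)
    a = 7 * n
    b = 7 * n' + 1
    Z = n ^ D * R0 ^ D * a ^ m
    R0pos : 1 ≤ R0
    R0pos = ≤-trans (s≤s z≤n) n³≤R0′
    Zpos : 1 ≤ Z
    Zpos = *-mono-≤ (*-mono-≤ (1≤m⇒1≤m^n n D (s≤s z≤n)) (1≤m⇒1≤m^n R0 D R0pos)) (1≤m⇒1≤m^n a m (s≤s z≤n))
    Rm : R0 ^ m * a ^ m ≡ b ^ m * T ^ m
    Rm = trans (sym (^-distribʳ-* R0 a m)) (trans (cong (_^ m) (trans (*-comm R0 a) R0-ratio)) (^-distribʳ-* b T m))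
    identity₀ : ∀ s c k a → s * c * (k * a) ≡ s * (c * k) * a
    identity₀ = solve-∀
    identity₁ : ∀ s d n f g h r a → s * (d * (n * (f * g * h * r))) * a ≡ s * d * f * n * g * h * (r * a)
    identity₁ = solve-∀
    identity₂ : ∀ X h b t → X * h * (b * t) ≡ (X * b) * (h * t)
    identity₂ = solve-∀
    identity₃ : ∀ N a h t → (N * a) * (h * t) ≡ t * (N * h * a)
    identity₃ = solve-∀


lemma5 : (p q : ℕ) → 1 ≤ q → 7 * q < 6 * p →
    (d₁ d₂ : ℕ) → 1 ≤ d₁ → 1 ≤ d₂ →
    (k : ℕ) → ∃ λ N → (n m : ℕ) → N ≤ n → DensityAtLeast p q n m →
    suc k * countF n m (badEvent d₁ d₂) ≤ countF n m (λ _ → true)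
lemma5 p q q≥1 7q<6p d₁ d₂ _ _ k = suc (suc (N₀ + 25)) , bound
  where
  D = d₁ + d₁ + d₂
  dominates = density⇒dominates p q q≥1 7q<6p (suc k * d₂ * 42 ^ D) D
  N₀ = proj₁ dominates
  bound : (n m : ℕ) → suc (suc (N₀ + 25)) ≤ n → DensityAtLeast p q n m →
    suc k * countF n m (badEvent d₁ d₂) ≤ countF n m (λ _ → true)
  bound (suc (suc t)) m (s≤s (s≤s N₀+25≤t)) dens =
    subst (suc k * countF (suc (suc t)) m (badEvent d₁ d₂) ≤_) (sym (countF-true (suc (suc t)) m))
      (Assembly.badEvent-bound t m d₁ d₂ (≤-trans (m≤n+m 25 N₀) N₀+25≤t) k
        (proj₂ dominates (suc t) m (≤-trans (≤-trans (m≤m+n N₀ 25) N₀+25≤t) (n≤1+n t)) dens))
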